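{- Let $f_3$ be the morphism on the alphabet $\{0,1,\dots,21\}$ (each number is a single letter) given by $0\mapsto 0\,1$, $1\mapsto 2$, $2\mapsto 3\,4$, $3\mapsto 5\,6$, $4\mapsto 7$, $5\mapsto 8\,9$, $6\mapsto 10$, $7\mapsto 11\,12$, $8\mapsto 13\,12$, $9\mapsto 14$, $10\mapsto 15\,16$, $11\mapsto 14\,17$, $12\mapsto 18$, $13\mapsto 14\,17$, $14\mapsto 19\,12$, $15\mapsto 18\,20$, $16\mapsto 21$, $17\mapsto 18$, $18\mapsto 13\,12$, $19\mapsto 19\,12$, $20\mapsto 14$, $21\mapsto 15\,16$, and $g_3$ the coding $0,1,2,3,5,7,9,11,12,14,16,18,21\mapsto a$, $4,6,8,10,13,15,17,19,20\mapsto b$. Then $f_3$ is a $\varphi$-morphism, and the infinite word $g_3(f_3^\omega(0))=w_4w_5w_6\cdots$, whose letters are indexed starting from $4$, codes the non-terminal $\mathcal{P}$-positions of $K^3$: for every $n\ge 0$, $a_n$ is the index of the $(n+1)$-th occurrence of $a$ and $b_n$ is the index of the $(n+1)$-th occurrence of $b$ in this word.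
   Context: Positions are pairs $(x,y)\in\mathbb{N}^2$; a Wythoff move from $(x,y)$ leads to $(x-i,y)$ ($1\le i\le x$), $(x,y-i)$ ($1\le i\le y$) or $(x-i,y-i)$ ($1\le i\le\min(x,y)$). For $\ell\in\mathbb{N}$, $K^\ell$ is the impartial game with Wythoff moves in which the positions of $\{(x,y):x+y\le\ell\}$ are terminal: no move is allowed from them and a player who moves into one wins (normal play). A $\mathcal{P}$-position is one from which the previous player wins. The non-terminal $\mathcal{P}$-positions $(a,b)$ with $a<b$, listed in increasing order of $a$, are $(a_n,b_n)$, $n\ge0$. $f_3^\omega(0)$ denotes the fixed point of $f_3$ beginning with $0$. Fibonacci representation: $F_0=1,F_1=2,F_{n+2}=F_{n+1}+F_n$; $\mathrm{rep}_F(n)$ is the greedy representation of $n$ over $\{0,1\}$ without consecutive $1$'s ($\mathrm{rep}_F(0)$ empty, regarded as ending with $0$); for a word $u$, $[u]$ denotes the integer it represents. A morphism $\mu$ is a $\varphi$-morphism if its fixed point $\mathbf{w}=w_0w_1\cdots$ satisfies, for every $n$: if $\mathrm{rep}_F(n)$ ends with $1$ then $\mu(w_n)=w_{[\mathrm{rep}_F(n)0]}$, and if it ends with $0$ then $\mu(w_n)=w_{[\mathrm{rep}_F(n)0]}w_{[\mathrm{rep}_F(n)1]}$. -}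

module Defs where

open import Data.Nat using (ℕ; zero; suc; _+_; _∸_; _≤_; _<_; _≤ᵇ_)
open import Data.Bool using (Bool; true; false; if_then_else_; not; _∨_)
open import Data.Fin using (Fin; #_)
open import Data.List using (List; []; _∷_; _++_; reverse; concatMap)
open import Data.Vec using (Vec; lookup) renaming ([] to []ᵥ; _∷_ to _∷ᵥ_)
open import Data.Product using (Σ; _×_)
open import Relation.Binary.PropositionalEquality using (_≡_)

-- Terminal positions: x + y ≤ ℓ.
-- isP ℓ x y = true  iff  (x , y) is a P-position of K^ℓ (normal play).
-- Terminal positions are P-positions (no move available); a non-terminal
-- position is a P-position iff no Wythoff move leads to a P-position.

module _ (ℓ : ℕ) where
  mutual
    isP : ℕ → ℕ → Bool
    isP x y = if (x + y) ≤ᵇ ℓ then true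
              else not (leftP x y ∨ (downP x y ∨ diagP x y))

    leftP : ℕ → ℕ → Bool
    leftP zero    y = false
    leftP (suc k) y = isP k y ∨ leftP k y

    downP : ℕ → ℕ → Bool
    downP x zero    = false
    downP x (suc k) = isP x k ∨ downP x k

    diagP : ℕ → ℕ → Bool
    diagP zero    y       = false
    diagP (suc x) zero    = false
    diagP (suc x) (suc y) = isP x y ∨ diagP x y

NonTermP : ℕ → ℕ → ℕ → Set
NonTermP ℓ x y = (ℓ < x + y) × (isP ℓ x y ≡ true)

Letter : Set
Letter = Fin 22

f3table : Vec (List Letter) 22
f3table =
  (# 0 ∷ # 1 ∷ []) ∷ᵥ
  (# 2 ∷ []) ∷ᵥ
  (# 3 ∷ # 4 ∷ []) ∷ᵥ
  (# 5 ∷ # 6 ∷ []) ∷ᵥ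
  (# 7 ∷ []) ∷ᵥ
  (# 8 ∷ # 9 ∷ []) ∷ᵥ
  (# 10 ∷ []) ∷ᵥ
  (# 11 ∷ # 12 ∷ []) ∷ᵥ
  (# 13 ∷ # 12 ∷ []) ∷ᵥ
  (# 14 ∷ []) ∷ᵥ
  (# 15 ∷ # 16 ∷ []) ∷ᵥ
  (# 14 ∷ # 17 ∷ []) ∷ᵥ
  (# 18 ∷ []) ∷ᵥ
  (# 14 ∷ # 17 ∷ []) ∷ᵥ
  (# 19 ∷ # 12 ∷ []) ∷ᵥ
  (# 18 ∷ # 20 ∷ []) ∷ᵥ
  (# 21 ∷ []) ∷ᵥ
  (# 18 ∷ []) ∷ᵥ
  (# 13 ∷ # 12 ∷ []) ∷ᵥ
  (# 19 ∷ # 12 ∷ []) ∷ᵥ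
  (# 14 ∷ []) ∷ᵥ
  (# 15 ∷ # 16 ∷ []) ∷ᵥ
  []ᵥ

f3 : Letter → List Letter
f3 c = lookup f3table c

data AB : Set where
  a b : AB

g3table : Vec AB 22
g3table =
  a ∷ᵥ a ∷ᵥ a ∷ᵥ a ∷ᵥ b ∷ᵥ a ∷ᵥ b ∷ᵥ a ∷ᵥ b ∷ᵥ a ∷ᵥ b ∷ᵥ
  a ∷ᵥ a ∷ᵥ b ∷ᵥ a ∷ᵥ b ∷ᵥ a ∷ᵥ b ∷ᵥ a ∷ᵥ b ∷ᵥ b ∷ᵥ a ∷ᵥ
  []ᵥ

g3 : Letter → AB
g3 c = lookup g3table c

iterate : {A : Set} → (A → List A) → ℕ → List A → List A
iterate μ zero    u = u
iterate μ (suc k) u = concatMap μ (iterate μ k u)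

nth : {A : Set} → A → List A → ℕ → A
nth d []       i       = d
nth d (x ∷ xs) zero    = x
nth d (x ∷ xs) (suc i) = nth d xs i

-- the fixed point f₃^ω(0): its i-th letter is the i-th letter of f₃^{i+1}(0)
-- (f₃(0) = 0 1, so f₃^k(0) is a prefix of f₃^{k+1}(0) of length ≥ k + 1).
fix3 : ℕ → Letter
fix3 i = nth (# 0) (iterate f3 (suc i) (# 0 ∷ [])) i

Fib : ℕ → ℕ
Fib zero          = 1
Fib (suc zero)    = 2
Fib (suc (suc n)) = Fib (suc n) + Fib n

greedy : ℕ → ℕ → List Bool
greedy zero    r = []
greedy (suc j) r = if Fib j ≤ᵇ r then true ∷ greedy j (r ∸ Fib j)
                   else false ∷ greedy j r

dropZeros : List Bool → List Bool
dropZeros []           = []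
dropZeros (false ∷ bs) = dropZeros bs
dropZeros (true ∷ bs)  = true ∷ bs

-- rep_F(n): greedy representation (F_n > n, so positions ≤ n suffice),
-- without leading zeros; rep_F(0) is empty.
repF : ℕ → List Bool
repF n = dropZeros (greedy (suc n) n)

valRev : ℕ → List Bool → ℕ
valRev k []           = 0
valRev k (false ∷ bs) = valRev (suc k) bs
valRev k (true ∷ bs)  = Fib k + valRev (suc k) bs

val : List Bool → ℕ
val u = valRev 0 (reverse u)

-- does the word end with 1?  (the empty word is regarded as ending with 0)
endsWith1 : List Bool → Bool
endsWith1 []           = false
endsWith1 (x ∷ [])     = x
endsWith1 (x ∷ y ∷ bs) = endsWith1 (y ∷ bs)

IsPhiMorphism : {A : Set} → (A → List A) → (ℕ → A) → Set
IsPhiMorphism μ w = (n : ℕ) →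
  if endsWith1 (repF n)
  then μ (w n) ≡ w (val (repF n ++ false ∷ [])) ∷ []
  else μ (w n) ≡ w (val (repF n ++ false ∷ [])) ∷ w (val (repF n ++ true ∷ [])) ∷ []

W : ℕ → AB
W m = g3 (fix3 (m ∸ 4))

_≟AB_ : AB → AB → Bool
a ≟AB a = true
b ≟AB b = true
_ ≟AB _ = false

countFrom4 : AB → ℕ → ℕ
countFrom4 c zero    = 0
countFrom4 c (suc k) = countFrom4 c k + (if W (4 + k) ≟AB c then 1 else 0)

IsOcc : AB → ℕ → ℕ → Set
IsOcc c n m = (4 ≤ m) × (W m ≡ c) × (countFrom4 c (m ∸ 4) ≡ n)

{-# OPTIONS --safe #-}

-- The fixed point w = f₃^ω(0) is the concatenation of the blocks f₃(w₀) f₃(w₁) ⋯, so every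
-- position k has a parent j (the block containing k) and an offset 0 or 1 in it. Since the first
-- letter of every image has an image of length 2 and the second letter one of length 1, w_k has a
-- long image exactly when k is at offset 0; hence the Fibonacci representation of k is that of its
-- parent followed by its offset, which is the φ-morphism property.
--
-- The number of a's among w₀ ⋯ w_{k-1} is parent k plus a correction depending only on w_k. A finite
-- set of windows (a letter with its three predecessors), closed under passing from a letter to its
-- children, lets one check locally that the n-th b of the coded word comes n + 4 letters after the
-- n-th a. The P-positions of K^ℓ form the unique set that contains the terminal positions, has no
-- move inside it and can be reached from every other position; pairs (a_n , b_n) with
-- b_n − a_n = n + ℓ + 1 whose entries partition {ℓ + 1, ℓ + 2, …} form such a set together with
-- the terminal positions.

module Submission where

open import Defs
open import Data.Nat
  using (ℕ; zero; suc; _+_; _*_; _∸_; _≤_; _<_; z≤n; s≤s; _≤′_; ≤′-refl; ≤′-step; _≤ᵇ_; _≡ᵇ_; _≤?_; _<?_)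
open import Data.Nat.Properties
open import Data.Nat.Induction using (<-rec)
open import Data.Nat.Solver using (module +-*-Solver)
open import Data.Bool using (Bool; true; false; if_then_else_; not; _∨_)
import Data.Bool.Properties as Bool
open import Data.Fin using (#_)
import Data.Fin.Properties as Fin
open import Data.List using (List; []; _∷_; _++_; length; reverse; replicate; concatMap; applyUpTo; drop; take; map; foldl)
import Data.List.Properties as List
open import Data.List.Membership.Propositional using (_∈_)
open import Data.List.Relation.Unary.All as All using (All)
open import Data.List.Relation.Unary.Any using (here)
open import Data.Maybe using (Maybe; just; nothing)
import Data.Maybe.Properties as Maybe
open import Data.Product using (Σ; ∃; _×_; _,_; proj₁; proj₂)
import Data.Product.Properties as Product
open import Data.Sum using (_⊎_; inj₁; inj₂)
open import Data.Empty using (⊥)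
open import Data.Unit using (⊤; tt)
open import Data.Vec using (Vec; lookup) renaming ([] to []ᵥ; _∷_ to _∷ᵥ_)
open import Function using (_∘_; _⇔_; mk⇔; Equivalence)
open import Relation.Nullary using (Dec; yes; no; ¬_; contradiction)
open import Relation.Nullary.Decidable using (from-yes; _×-dec_; _⊎-dec_; _→-dec_)
open import Relation.Binary.Definitions using (DecidableEquality; tri<; tri≈; tri>)
open import Relation.Binary.PropositionalEquality
  using (_≡_; _≢_; refl; sym; trans; cong; cong₂; subst; subst₂; module ≡-Reasoning)

open +-*-Solver using (solve; _:+_; _:*_; _:=_; con)

-- Fibonacci numeration

bit : Bool → ℕ
bit true  = 1
bit false = 0

bit≤1 : ∀ t → bit t ≤ 1
bit≤1 true  = ≤-refl
bit≤1 false = z≤n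

mono-from-steps : ∀ (f : ℕ → ℕ) → (∀ n → f n ≤ f (suc n)) → ∀ {i j} → i ≤ j → f i ≤ f j
mono-from-steps f step i≤j = go (≤⇒≤′ i≤j)
  where
  go : ∀ {i j} → i ≤′ j → f i ≤ f j
  go ≤′-refl        = ≤-refl
  go (≤′-step i≤′j) = ≤-trans (go i≤′j) (step _)

fibDigit : ℕ → Bool → ℕ
fibDigit k d = if d then Fib k else 0

≤ᵇ-true : ∀ {m n} → m ≤ n → (m ≤ᵇ n) ≡ true
≤ᵇ-true m≤n = Equivalence.to Bool.T-≡ (≤⇒≤ᵇ m≤n)

≤ᵇ-false : ∀ {m n} → n < m → (m ≤ᵇ n) ≡ false
≤ᵇ-false {m} {n} n<m = Bool.¬-not (<⇒≱ n<m ∘ ≤ᵇ⇒≤ m n ∘ Equivalence.from Bool.T-≡)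

Fib-mono-suc : ∀ i → Fib i ≤ Fib (suc i)
Fib-mono-suc zero    = s≤s z≤n
Fib-mono-suc (suc i) = m≤m+n _ _

Fib-mono : ∀ {i j} → i ≤ j → Fib i ≤ Fib j
Fib-mono = mono-from-steps Fib Fib-mono-suc

n<Fib : ∀ n → n < Fib n
n<Fib zero          = s≤s z≤n
n<Fib (suc zero)    = ≤-refl
n<Fib (suc (suc n)) = subst (_≤ Fib (suc n) + Fib n) (+-comm (suc (suc n)) 1)
  (+-mono-≤ (n<Fib (suc n)) (≤-trans (s≤s z≤n) (n<Fib n)))

valRev-suc² : ∀ k ds → valRev (2 + k) ds ≡ valRev (1 + k) ds + valRev k ds
valRev-suc² k []           = refl
valRev-suc² k (false ∷ ds) = valRev-suc² (suc k) ds
valRev-suc² k (true ∷ ds)  rewrite valRev-suc² (suc k) ds =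
  solve 5 (λ f₁ f₀ v₂ v₁ v₀ → (f₁ :+ f₀) :+ (v₂ :+ v₁) := (f₁ :+ v₂) :+ (f₀ :+ v₁)) refl
    (Fib (suc k)) (Fib k) (valRev (2 + k) ds) (valRev (1 + k) ds) (valRev k ds)

valRev-snoc : ∀ k ds d → valRev k (ds ++ d ∷ []) ≡ valRev k ds + fibDigit (k + length ds) d
valRev-snoc k []           true  = trans (+-identityʳ _) (cong Fib (sym (+-identityʳ k)))
valRev-snoc k []           false = refl
valRev-snoc k (false ∷ ds) d     rewrite +-suc k (length ds) = valRev-snoc (suc k) ds d
valRev-snoc k (true ∷ ds)  d     rewrite +-suc k (length ds) =
  trans (cong (Fib k +_) (valRev-snoc (suc k) ds d)) (sym (+-assoc (Fib k) _ _))

val-cons : ∀ d u → val (d ∷ u) ≡ fibDigit (length u) d + val u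
val-cons d u = begin
  valRev 0 (reverse (d ∷ u))                   ≡⟨ cong (valRev 0) (List.unfold-reverse d u) ⟩
  valRev 0 (reverse u ++ d ∷ [])               ≡⟨ valRev-snoc 0 (reverse u) d ⟩
  val u + fibDigit (length (reverse u)) d      ≡⟨ cong (λ n → val u + fibDigit n d) (List.length-reverse u) ⟩
  val u + fibDigit (length u) d                ≡⟨ +-comm (val u) _ ⟩
  fibDigit (length u) d + val u                ∎
  where open ≡-Reasoning

-- shiftedVal u = [u0]
shiftedVal : List Bool → ℕ
shiftedVal u = valRev 1 (reverse u)

val-snoc : ∀ u d → val (u ++ d ∷ []) ≡ bit d + shiftedVal u
val-snoc u true  = cong (valRev 0) (List.reverse-++ u (true ∷ []))
val-snoc u false = cong (valRev 0) (List.reverse-++ u (false ∷ []))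

shiftedVal-snoc : ∀ u d → shiftedVal (u ++ d ∷ []) ≡ fibDigit 1 d + (shiftedVal u + val u)
shiftedVal-snoc u true  =
  trans (cong (valRev 1) (List.reverse-++ u (true ∷ []))) (cong (2 +_) (valRev-suc² 0 (reverse u)))
shiftedVal-snoc u false =
  trans (cong (valRev 1) (List.reverse-++ u (false ∷ []))) (valRev-suc² 0 (reverse u))

endsWith1-snoc : ∀ u d → endsWith1 (u ++ d ∷ []) ≡ d
endsWith1-snoc []          d = refl
endsWith1-snoc (_ ∷ [])    d = refl
endsWith1-snoc (_ ∷ e ∷ u) d = endsWith1-snoc (e ∷ u) d

NoLeading0 : List Bool → Set
NoLeading0 (false ∷ _) = ⊥
NoLeading0 _           = ⊤

No11 : List Bool → Set
No11 []                  = ⊤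
No11 (_ ∷ [])            = ⊤
No11 (true ∷ true ∷ _)   = ⊥
No11 (true ∷ false ∷ u)  = No11 (false ∷ u)
No11 (false ∷ e ∷ u)     = No11 (e ∷ u)

No11-tail : ∀ d u → No11 (d ∷ u) → No11 u
No11-tail _     []          _ = tt
No11-tail true  (false ∷ u) n = n
No11-tail false (_ ∷ u)     n = n

NoLeading0-snoc : ∀ u d → NoLeading0 u → (u ≡ [] → d ≡ true) → NoLeading0 (u ++ d ∷ [])
NoLeading0-snoc []         d     _ d≡1 with d≡1 refl
... | refl = tt
NoLeading0-snoc (true ∷ u) d     _ _ = tt

No11-snoc : ∀ u d → No11 u → (d ≡ true → endsWith1 u ≡ false) → No11 (u ++ d ∷ [])
No11-snoc []                d     _ _ = tt
No11-snoc (true ∷ [])       true  _ h with h refl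
... | ()
No11-snoc (true ∷ [])       false _ _ = tt
No11-snoc (false ∷ [])      d     _ _ = tt
No11-snoc (true ∷ false ∷ u) d    n h = No11-snoc (false ∷ u) d n h
No11-snoc (false ∷ e ∷ u)   d     n h = No11-snoc (e ∷ u) d n h

val<Fib : ∀ u → No11 u → val u < Fib (length u)
val<Fib []                 _ = s≤s z≤n
val<Fib (true ∷ [])        _ = s≤s (s≤s z≤n)
val<Fib (false ∷ u)        n rewrite val-cons false u =
  <-≤-trans (val<Fib u (No11-tail false u n)) (Fib-mono-suc (length u))
val<Fib (true ∷ false ∷ u) n rewrite val-cons true (false ∷ u) | val-cons false u =
  +-monoʳ-< (Fib (suc (length u))) (val<Fib u (No11-tail false u n))

greedy-val : ∀ u → No11 u → greedy (length u) (val u) ≡ u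
greedy-val []          _ = refl
greedy-val (true ∷ u)  n
  rewrite val-cons true u | ≤ᵇ-true (m≤m+n (Fib (length u)) (val u)) | m+n∸m≡n (Fib (length u)) (val u)
  = cong (true ∷_) (greedy-val u (No11-tail true u n))
greedy-val (false ∷ u) n
  rewrite val-cons false u | ≤ᵇ-false (val<Fib u (No11-tail false u n))
  = cong (false ∷_) (greedy-val u (No11-tail false u n))

greedy-pad : ∀ t l r → r < Fib l → greedy (t + l) r ≡ replicate t false ++ greedy l r
greedy-pad zero    l r r<F = refl
greedy-pad (suc t) l r r<F rewrite ≤ᵇ-false (<-≤-trans r<F (Fib-mono (m≤n+m l t))) =
  cong (false ∷_) (greedy-pad t l r r<F)

dropZeros-pad : ∀ t u → NoLeading0 u → dropZeros (replicate t false ++ u) ≡ u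
dropZeros-pad zero    []         _ = refl
dropZeros-pad zero    (true ∷ u) _ = refl
dropZeros-pad (suc t) u          l = dropZeros-pad t u l

length≤val : ∀ u → NoLeading0 u → length u ≤ suc (val u)
length≤val []         _ = z≤n
length≤val (true ∷ u) _ rewrite val-cons true u =
  s≤s (≤-trans (<⇒≤ (n<Fib (length u))) (m≤m+n _ _))

repF-val : ∀ u → NoLeading0 u → No11 u → repF (val u) ≡ u
repF-val u l n = begin
  dropZeros (greedy (suc (val u)) (val u))                    ≡⟨ cong (λ m → dropZeros (greedy m (val u))) (sym pad) ⟩
  dropZeros (greedy (t + length u) (val u))                   ≡⟨ cong dropZeros (greedy-pad t (length u) (val u) (val<Fib u n)) ⟩
  dropZeros (replicate t false ++ greedy (length u) (val u))  ≡⟨ cong (λ v → dropZeros (replicate t false ++ v)) (greedy-val u n) ⟩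
  dropZeros (replicate t false ++ u)                          ≡⟨ dropZeros-pad t u l ⟩
  u                                                           ∎
  where
  open ≡-Reasoning
  t = suc (val u) ∸ length u
  pad : t + length u ≡ suc (val u)
  pad = m∸n+n≡m (length≤val u l)

-- The games K^ℓ

module _ (ℓ : ℕ) where

  data Move (Q : ℕ → ℕ → Set) (x y : ℕ) : Set where
    left : ∀ {x'} → x' < x → Q x' y → Move Q x y
    down : ∀ {y'} → y' < y → Q x y' → Move Q x y
    diag : ∀ d {x' y'} → x ≡ suc d + x' → y ≡ suc d + y' → Q x' y' → Move Q x y

  Move-map : ∀ {Q R : ℕ → ℕ → Set} {x y} →
    (∀ {x' y'} → x' + y' < x + y → Q x' y' → R x' y') → Move Q x y → Move R x y
  Move-map {x = x} {y} f (left x'<x q) = left x'<x (f (+-monoˡ-< y x'<x) q)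
  Move-map {x = x} {y} f (down y'<y q) = down y'<y (f (+-monoʳ-< x y'<y) q)
  Move-map {x = x} {y} f (diag d {x'} {y'} refl refl q) = diag d refl refl (f smaller q)
    where
    smaller : x' + y' < suc d + x' + (suc d + y')
    smaller = +-mono-<-≤ (s≤s (m≤n+m x' d)) (≤-trans (m≤n+m y' d) (n≤1+n _))

  Move-swap : ∀ {Q : ℕ → ℕ → Set} {x y} → Move (λ x' y' → Q y' x') y x → Move Q x y
  Move-swap (left x'<x q)      = down x'<x q
  Move-swap (down y'<y q)      = left y'<y q
  Move-swap (diag d ex ey q)   = diag d ey ex q

  IsP : ℕ → ℕ → Set
  IsP x y = isP ℓ x y ≡ true

  movesToP : ℕ → ℕ → Bool
  movesToP x y = leftP ℓ x y ∨ (downP ℓ x y ∨ diagP ℓ x y)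

  isP-terminal : ∀ {x y} → x + y ≤ ℓ → IsP x y
  isP-terminal {x} {y} t = cong (if_then true else not (movesToP x y)) (≤ᵇ-true t)

  isP-nonterminal : ∀ {x y} → ℓ < x + y → isP ℓ x y ≡ not (movesToP x y)
  isP-nonterminal {x} {y} nt = cong (if_then true else not (movesToP x y)) (≤ᵇ-false nt)

  leftP-sound : ∀ x y → leftP ℓ x y ≡ true → ∃ λ x' → x' < x × IsP x' y
  leftP-sound (suc x) y e with isP ℓ x y in p
  ... | true  = x , ≤-refl , p
  ... | false with leftP-sound x y e
  ...   | x' , x'<x , q = x' , m<n⇒m<1+n x'<x , q

  leftP-complete : ∀ {x' x y} → x' < x → IsP x' y → leftP ℓ x y ≡ true
  leftP-complete {x'} {suc x} {y} (s≤s x'≤x) q with m≤n⇒m<n∨m≡n x'≤x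
  ... | inj₂ refl = cong (_∨ leftP ℓ x' y) q
  ... | inj₁ x'<x = trans (cong (isP ℓ x y ∨_) (leftP-complete x'<x q)) (Bool.∨-zeroʳ _)

  downP-sound : ∀ x y → downP ℓ x y ≡ true → ∃ λ y' → y' < y × IsP x y'
  downP-sound x (suc y) e with isP ℓ x y in p
  ... | true  = y , ≤-refl , p
  ... | false with downP-sound x y e
  ...   | y' , y'<y , q = y' , m<n⇒m<1+n y'<y , q

  downP-complete : ∀ {y' x y} → y' < y → IsP x y' → downP ℓ x y ≡ true
  downP-complete {y'} {x} {suc y} (s≤s y'≤y) q with m≤n⇒m<n∨m≡n y'≤y
  ... | inj₂ refl = cong (_∨ downP ℓ x y') q
  ... | inj₁ y'<y = trans (cong (isP ℓ x y ∨_) (downP-complete y'<y q)) (Bool.∨-zeroʳ _)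

  diagP-sound : ∀ x y → diagP ℓ x y ≡ true →
    ∃ λ d → ∃ λ x' → ∃ λ y' → x ≡ suc d + x' × y ≡ suc d + y' × IsP x' y'
  diagP-sound (suc x) (suc y) e with isP ℓ x y in p
  ... | true  = 0 , x , y , refl , refl , p
  ... | false with diagP-sound x y e
  ...   | d , x' , y' , ex , ey , q = suc d , x' , y' , cong suc ex , cong suc ey , q

  diagP-complete : ∀ d {x' y'} → IsP x' y' → diagP ℓ (suc d + x') (suc d + y') ≡ true
  diagP-complete zero    {x'} {y'} q = cong (_∨ diagP ℓ x' y') q
  diagP-complete (suc d) {x'} {y'} q =
    trans (cong (isP ℓ (suc d + x') (suc d + y') ∨_) (diagP-complete d q)) (Bool.∨-zeroʳ _)

  movesToP-sound : ∀ x y → movesToP x y ≡ true → Move IsP x y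
  movesToP-sound x y e with leftP ℓ x y in l | downP ℓ x y in dn | diagP ℓ x y in dg
  ... | true  | _     | _    = let x' , lt , q = leftP-sound x y l in left lt q
  ... | false | true  | _    = let y' , lt , q = downP-sound x y dn in down lt q
  ... | false | false | true = let d , x' , y' , ex , ey , q = diagP-sound x y dg in diag d ex ey q

  movesToP-complete : ∀ {x y} → Move IsP x y → movesToP x y ≡ true
  movesToP-complete {x} {y} (left lt q) = cong (_∨ (downP ℓ x y ∨ diagP ℓ x y)) (leftP-complete lt q)
  movesToP-complete {x} {y} (down lt q) =
    trans (cong (λ t → leftP ℓ x y ∨ (t ∨ diagP ℓ x y)) (downP-complete lt q)) (Bool.∨-zeroʳ _)
  movesToP-complete {x} {y} (diag d refl refl q) =
    trans (cong (λ t → leftP ℓ x y ∨ (downP ℓ x y ∨ t)) (diagP-complete d q))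
          (trans (cong (leftP ℓ x y ∨_) (Bool.∨-zeroʳ _)) (Bool.∨-zeroʳ _))

  isP⇔kernel : (Q : ℕ → ℕ → Set) →
    (∀ {x y} → x + y ≤ ℓ → Q x y) →
    (∀ {x y} → ℓ < x + y → Q x y → ¬ Move Q x y) →
    (∀ {x y} → ℓ < x + y → Q x y ⊎ Move Q x y) →
    ∀ x y → IsP x y ⇔ Q x y
  isP⇔kernel Q terminal stable absorbing x y = go (suc (x + y)) x y ≤-refl
    where
    go : ∀ s x y → x + y < s → IsP x y ⇔ Q x y
    go (suc s) x y (s≤s x+y≤s) with x + y ≤? ℓ
    ... | yes t = mk⇔ (λ _ → terminal t) (λ _ → isP-terminal {x} {y} t)
    ... | no nt = mk⇔ to from
      where
      ℓ<x+y : ℓ < x + y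
      ℓ<x+y = ≰⇒> nt
      below : ∀ {x' y'} → x' + y' < x + y → IsP x' y' ⇔ Q x' y'
      below lt = go s _ _ (<-≤-trans lt x+y≤s)
      to : IsP x y → Q x y
      to p with absorbing ℓ<x+y
      ... | inj₁ q = q
      ... | inj₂ m with () ← trans (sym p) (trans (isP-nonterminal {x} {y} ℓ<x+y)
                               (cong not (movesToP-complete (Move-map (Equivalence.from ∘ below) m))))
      from : Q x y → IsP x y
      from q = trans (isP-nonterminal {x} {y} ℓ<x+y) (cong not (Bool.¬-not no-move))
        where
        no-move : movesToP x y ≢ true
        no-move e = stable ℓ<x+y q (Move-map (Equivalence.to ∘ below) (movesToP-sound x y e))

-- Occurrences of letters in a binary word, and the pairs they define

module Occurrences (u : ℕ → AB) where

  count : AB → ℕ → ℕ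
  count c zero    = 0
  count c (suc k) = count c k + (if u k ≟AB c then 1 else 0)

  count-hit : ∀ {c k} → u k ≡ c → count c (suc k) ≡ suc (count c k)
  count-hit {a} {k} e rewrite e = +-comm (count a k) 1
  count-hit {b} {k} e rewrite e = +-comm (count b k) 1

  count-a+b : ∀ k → count a k + count b k ≡ k
  count-a+b zero = refl
  count-a+b (suc k) with u k
  ... | a = trans (cong₂ _+_ (+-comm (count a k) 1) (+-identityʳ _)) (cong suc (count-a+b k))
  ... | b = trans (cong₂ _+_ (+-identityʳ (count a k)) (+-comm (count b k) 1))
                  (trans (+-suc (count a k) (count b k)) (cong suc (count-a+b k)))

  count-mono : ∀ c {i j} → i ≤ j → count c i ≤ count c j
  count-mono c = mono-from-steps (count c) (λ k → m≤m+n (count c k) _)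

  count-strict : ∀ {c i j} → u i ≡ c → i < j → count c i < count c j
  count-strict {c} {i} e i<j = ≤-trans (≤-reflexive (sym (count-hit e))) (count-mono c i<j)

  count-injective : ∀ {c i j} → u i ≡ c → u j ≡ c → count c i ≡ count c j → i ≡ j
  count-injective ei ej e with <-cmp _ _
  ... | tri< i<j _ _ = contradiction e (<⇒≢ (count-strict ei i<j))
  ... | tri≈ _ i≡j _ = i≡j
  ... | tri> _ _ j<i = contradiction (sym e) (<⇒≢ (count-strict ej j<i))

  count-reflects-< : ∀ {c i j} → u j ≡ c → count c i < count c j → i < j
  count-reflects-< {c} {i} {j} ej lt with <-cmp i j
  ... | tri< i<j _ _ = i<j
  ... | tri≈ _ refl _ = contradiction lt (<-irrefl refl)
  ... | tri> _ _ j<i = contradiction lt (<-asym (count-strict ej j<i))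

  occurrence-below : ∀ c {n} K → n < count c K → ∃ λ k → u k ≡ c × count c k ≡ n
  occurrence-below c {n} (suc K) lt with n <? count c K
  ... | yes n<K = occurrence-below c K n<K
  ... | no  n≮K with u K ≟AB c in e
  ...   | false = contradiction (subst (n <_) (+-identityʳ _) lt) n≮K
  ...   | true  = K , ≟AB-sound e , ≤-antisym (≮⇒≥ n≮K) (≤-pred (subst (n <_) (+-comm _ 1) lt))
    where
    ≟AB-sound : ∀ {c d} → (c ≟AB d) ≡ true → c ≡ d
    ≟AB-sound {a} {a} _ = refl
    ≟AB-sound {b} {b} _ = refl

module PairPositions (ℓ : ℕ) (u : ℕ → AB) where

  open Occurrences u

  Occ : AB → ℕ → ℕ → Set
  Occ c n m = suc ℓ ≤ m × u (m ∸ suc ℓ) ≡ c × count c (m ∸ suc ℓ) ≡ n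

  Pair : ℕ → ℕ → Set
  Pair x y = ∃ λ n → Occ a n x × Occ b n y

  GappedPair : ℕ → Set
  GappedPair n = ∃ λ x → ∃ λ y → Occ a n x × Occ b n y × y ≡ x + n + suc ℓ

  Candidate : ℕ → ℕ → Set
  Candidate x y = x + y ≤ ℓ ⊎ Pair x y ⊎ Pair y x

  Candidate-swap : ∀ {x y} → Candidate x y → Candidate y x
  Candidate-swap {x} {y} (inj₁ t)        = inj₁ (subst (_≤ ℓ) (+-comm x y) t)
  Candidate-swap         (inj₂ (inj₁ p)) = inj₂ (inj₂ p)
  Candidate-swap         (inj₂ (inj₂ p)) = inj₂ (inj₁ p)

  Occ-unique : ∀ {c n x x'} → Occ c n x → Occ c n x' → x ≡ x'
  Occ-unique (h , e , k) (h' , e' , k') =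
    trans (sym (m+[n∸m]≡n h))
      (trans (cong (suc ℓ +_) (count-injective e e' (trans k (sym k')))) (m+[n∸m]≡n h'))

  Occ-index-unique : ∀ {c n m x} → Occ c n x → Occ c m x → n ≡ m
  Occ-index-unique (_ , _ , k) (_ , _ , k') = trans (sym k) k'

  Occ-letter-unique : ∀ {n m x} → Occ a n x → Occ b m x → ⊥
  Occ-letter-unique (_ , ea , _) (_ , eb , _) with () ← trans (sym ea) eb

  Occ-ordered : ∀ {c m n x' x} → Occ c m x' → Occ c n x → m < n → x' < x
  Occ-ordered (h' , _ , k') (h , e , k) m<n =
    subst₂ _<_ (m+[n∸m]≡n h') (m+[n∸m]≡n h)
      (+-monoʳ-< (suc ℓ) (count-reflects-< e (subst₂ _<_ (sym k') (sym k) m<n)))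

  Occ-nonterminal : ∀ {c n x y} → Occ c n y → ¬ (x + y ≤ ℓ)
  Occ-nonterminal {x = x} {y} (h , _ , _) t = <⇒≱ (≤-trans h (m≤n+m y x)) t

  gap-pos : ∀ x n → x < x + n + suc ℓ
  gap-pos x n = ≤-trans (s≤s (m≤m+n x n)) (≤-trans (m≤m+n (suc (x + n)) ℓ) (≤-reflexive (sym (+-suc (x + n) ℓ))))

  diagonal : ∀ {Q : ℕ → ℕ → Set} {x y x'} → x' < x → x ≤ y → Q x' (x' + (y ∸ x)) → Move ℓ Q x y
  diagonal {Q} {x} {y} {x'} x'<x x≤y q = diag t ex ey q
    where
    t = x ∸ suc x'
    ex : x ≡ suc t + x'
    ex = sym (trans (sym (+-suc t x')) (m∸n+n≡m x'<x))
    ey : y ≡ suc t + (x' + (y ∸ x))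
    ey = trans (sym (m+[n∸m]≡n x≤y)) (trans (cong (_+ (y ∸ x)) ex) (+-assoc (suc t) x' (y ∸ x)))

  module _ (pairing : ∀ n → GappedPair n) where

    pair-gap : ∀ {n x y} → Occ a n x → Occ b n y → y ≡ x + n + suc ℓ
    pair-gap {n} ox oy with pairing n
    ... | _ , _ , ox₀ , oy₀ , gap₀ =
      trans (Occ-unique oy oy₀) (trans gap₀ (cong (λ t → t + n + suc ℓ) (Occ-unique ox₀ ox)))

    Pair-< : ∀ {x y} → Pair x y → x < y
    Pair-< {x} (n , ox , oy) = subst (x <_) (sym (pair-gap ox oy)) (gap-pos x n)

    Pair-stable : ∀ {x y} → Pair x y → ¬ Move ℓ Candidate x y
    Pair-stable (n , ox , oy) (left x'<x (inj₁ t)) = Occ-nonterminal oy t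
    Pair-stable (n , ox , oy) (left x'<x (inj₂ (inj₁ (m , ox' , oy')))) =
      <-irrefl (Occ-unique (subst (λ k → Occ a k _) (Occ-index-unique oy' oy) ox') ox) x'<x
    Pair-stable (n , ox , oy) (left x'<x (inj₂ (inj₂ (m , oy' , _)))) = Occ-letter-unique oy' oy
    Pair-stable {x} (n , ox , oy) (down {y'} y'<y (inj₁ t)) =
      Occ-nonterminal {x = y'} ox (subst (_≤ ℓ) (+-comm x y') t)
    Pair-stable (n , ox , oy) (down y'<y (inj₂ (inj₁ (m , ox' , oy')))) =
      <-irrefl (Occ-unique (subst (λ k → Occ b k _) (Occ-index-unique ox' ox) oy') oy) y'<y
    Pair-stable (n , ox , oy) (down y'<y (inj₂ (inj₂ (m , oy' , ox')))) = Occ-letter-unique ox ox'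
    Pair-stable (n , ox , oy) (diag d {x'} {y'} refl refl q) = excluded q
      where
      gap : y' ≡ x' + n + suc ℓ
      gap = +-cancelˡ-≡ (suc d) y' _
        (trans (pair-gap ox oy) (trans (+-assoc (suc d + x') n (suc ℓ))
          (trans (+-assoc (suc d) x' (n + suc ℓ)) (cong (suc d +_) (sym (+-assoc x' n (suc ℓ)))))))
      excluded : ¬ Candidate x' y'
      excluded (inj₁ t) =
        <⇒≱ (≤-trans (≤-trans (m≤n+m (suc ℓ) (x' + n)) (≤-reflexive (sym gap))) (m≤n+m y' x')) t
      excluded (inj₂ (inj₁ (m , ox' , oy'))) = <-irrefl (Occ-unique ox'' ox) (s≤s (m≤n+m x' d))
        where
        m≡n : m ≡ n
        m≡n = +-cancelʳ-≡ (suc ℓ) m n (+-cancelˡ-≡ x' _ _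
          (trans (sym (+-assoc x' m (suc ℓ))) (trans (sym (pair-gap ox' oy')) (trans gap (+-assoc x' n (suc ℓ))))))
        ox'' : Occ a n x'
        ox'' = subst (λ k → Occ a k x') m≡n ox'
      excluded (inj₂ (inj₂ p)) = <-asym (subst (x' <_) (sym gap) (gap-pos x' n)) (Pair-< p)

    Candidate-stable : ∀ {x y} → ℓ < x + y → Candidate x y → ¬ Move ℓ Candidate x y
    Candidate-stable nt (inj₁ t)        _ = <⇒≱ nt t
    Candidate-stable nt (inj₂ (inj₁ p)) m = Pair-stable p m
    Candidate-stable nt (inj₂ (inj₂ p)) m = Pair-stable p (Move-swap ℓ (Move-map ℓ (λ _ → Candidate-swap) m))

    absorbing-a : ∀ {n x y} → Occ a n x → x ≤ y → Candidate x y ⊎ Move ℓ Candidate x y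
    absorbing-a {n} {x} {y} ox x≤y with pairing n
    ... | _ , y₀ , _ , oy₀ , _ with <-cmp y y₀
    ...   | tri≈ _ refl _ = inj₁ (inj₂ (inj₁ (n , ox , oy₀)))
    ...   | tri> _ _ y₀<y = inj₂ (down y₀<y (inj₂ (inj₁ (n , ox , oy₀))))
    ...   | tri< y<y₀ _ _ with y ∸ x ≤? ℓ
    ...     | yes d≤ℓ = inj₂ (diagonal (≤-trans (s≤s z≤n) (proj₁ ox)) x≤y (inj₁ d≤ℓ))
    ...     | no  d≰ℓ = inj₂ (towards (pairing m))
      where
      d = y ∸ x
      m = d ∸ suc ℓ
      m+ℓ+1≡d : m + suc ℓ ≡ d
      m+ℓ+1≡d = m∸n+n≡m (≰⇒> d≰ℓ)
      d<n+ℓ+1 : d < n + suc ℓ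
      d<n+ℓ+1 = +-cancelˡ-< x d (n + suc ℓ)
        (subst₂ _<_ (sym (m+[n∸m]≡n x≤y)) (trans (pair-gap ox oy₀) (+-assoc x n (suc ℓ))) y<y₀)
      m<n : m < n
      m<n = +-cancelʳ-< (suc ℓ) m n (subst (_< n + suc ℓ) (sym m+ℓ+1≡d) d<n+ℓ+1)
      towards : GappedPair m → Move ℓ Candidate x y
      towards (xₘ , yₘ , oxₘ , oyₘ , gapₘ) =
        diagonal (Occ-ordered oxₘ ox m<n) x≤y (subst (Candidate xₘ) yₘ≡xₘ+d (inj₂ (inj₁ (m , oxₘ , oyₘ))))
        where
        yₘ≡xₘ+d : yₘ ≡ xₘ + d
        yₘ≡xₘ+d = trans gapₘ (trans (+-assoc xₘ m (suc ℓ)) (cong (xₘ +_) m+ℓ+1≡d))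

    absorbing-b : ∀ {n x y} → Occ b n x → x ≤ y → Move ℓ Candidate x y
    absorbing-b {n} {x} ox x≤y with pairing n
    ... | x₀ , _ , ox₀ , oy₀ , gap₀ = down (<-≤-trans x₀<x x≤y) (inj₂ (inj₂ (n , ox₀ , ox)))
      where
      x₀<x : x₀ < x
      x₀<x = subst (x₀ <_) (sym (trans (Occ-unique ox oy₀) gap₀)) (gap-pos x₀ n)

    absorbing-≤ : ∀ {x y} → x ≤ y → ℓ < x + y → Candidate x y ⊎ Move ℓ Candidate x y
    absorbing-≤ {x} {y} x≤y nt with x ≤? ℓ
    ... | yes x≤ℓ = inj₂ (down ℓ∸x<y (inj₁ (≤-reflexive (m+[n∸m]≡n x≤ℓ))))
      where
      ℓ∸x<y : ℓ ∸ x < y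
      ℓ∸x<y = +-cancelˡ-< x (ℓ ∸ x) y (subst (_< x + y) (sym (m+[n∸m]≡n x≤ℓ)) nt)
    ... | no x≰ℓ = by-letter _ refl
      where
      by-letter : ∀ c → u (x ∸ suc ℓ) ≡ c → Candidate x y ⊎ Move ℓ Candidate x y
      by-letter a e = absorbing-a (≰⇒> x≰ℓ , e , refl) x≤y
      by-letter b e = inj₂ (absorbing-b (≰⇒> x≰ℓ , e , refl) x≤y)

    Candidate-absorbing : ∀ {x y} → ℓ < x + y → Candidate x y ⊎ Move ℓ Candidate x y
    Candidate-absorbing {x} {y} nt with ≤-total x y
    ... | inj₁ x≤y = absorbing-≤ x≤y nt
    ... | inj₂ y≤x with absorbing-≤ y≤x (subst (ℓ <_) (+-comm x y) nt)
    ...   | inj₁ c = inj₁ (Candidate-swap c)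
    ...   | inj₂ m = inj₂ (Move-swap ℓ (Move-map ℓ (λ _ → Candidate-swap) m))

    isP⇔Candidate : ∀ x y → IsP ℓ x y ⇔ Candidate x y
    isP⇔Candidate = isP⇔kernel ℓ Candidate inj₁ Candidate-stable Candidate-absorbing

    Pair⇒nonterminalP : ∀ {x y} → Pair x y → ℓ < x + y × IsP ℓ x y
    Pair⇒nonterminalP {x} {y} p@(_ , ox , _) =
      ≤-trans (proj₁ ox) (m≤m+n x y) , Equivalence.from (isP⇔Candidate x y) (inj₂ (inj₁ p))

    nonterminalP⇒Pair : ∀ {x y} → ℓ < x + y → IsP ℓ x y → x < y → Pair x y
    nonterminalP⇒Pair {x} {y} nt p x<y with Equivalence.to (isP⇔Candidate x y) p
    ... | inj₁ t         = contradiction t (<⇒≱ nt)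
    ... | inj₂ (inj₁ xy) = xy
    ... | inj₂ (inj₂ yx) = contradiction x<y (<⇒≯ (Pair-< yx))

-- Morphisms of Fibonacci type

module _ {A : Set} (d : A) where

  nth-++ˡ : ∀ (xs ys : List A) {i} → i < length xs → nth d (xs ++ ys) i ≡ nth d xs i
  nth-++ˡ (x ∷ xs) ys {zero}  _         = refl
  nth-++ˡ (x ∷ xs) ys {suc i} (s≤s i<n) = nth-++ˡ xs ys i<n

  nth-++ʳ : ∀ (xs ys : List A) i → nth d (xs ++ ys) (length xs + i) ≡ nth d ys i
  nth-++ʳ []       ys i = refl
  nth-++ʳ (x ∷ xs) ys i = nth-++ʳ xs ys i

  agree-split : ∀ (f : ℕ → A) (xs : List A) j →
    (∀ i → i < length xs → nth d xs i ≡ f i) → j ≤ length xs → xs ≡ applyUpTo f j ++ drop j xs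
  agree-split f xs       zero    _  _           = refl
  agree-split f (x ∷ xs) (suc j) ag (s≤s j≤n) =
    cong₂ _∷_ (ag 0 (s≤s z≤n)) (agree-split (f ∘ suc) xs j (λ i i<n → ag (suc i) (s≤s i<n)) j≤n)

module Morphism {A : Set} (μ : A → List A) (z₀ : A) where

  fixedPoint : ℕ → A
  fixedPoint i = nth z₀ (iterate μ (suc i) (z₀ ∷ [])) i

  len : A → ℕ
  len z = length (μ z)

  long : A → Bool
  long z = len z ≡ᵇ 2

  first second : A → A
  first z  = nth z₀ (μ z) 0
  second z = nth z₀ (μ z) 1

  module FibonacciType
    (μ-shape      : ∀ z → μ z ≡ first z ∷ (if long z then second z ∷ [] else []))
    (first-long   : ∀ z → long (first z) ≡ true)
    (second-short : ∀ z → long z ≡ true → long (second z) ≡ false)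
    (first-z₀     : first z₀ ≡ z₀)
    where

    w : ℕ → A
    w = fixedPoint

    len-long : ∀ {z} → long z ≡ true → len z ≡ 2
    len-long {z} l = trans (cong length (μ-shape z)) (cong (λ t → suc (length (if t then second z ∷ [] else []))) l)

    len-short : ∀ {z} → long z ≡ false → len z ≡ 1
    len-short {z} l = trans (cong length (μ-shape z)) (cong (λ t → suc (length (if t then second z ∷ [] else []))) l)

    len≡1+long : ∀ z → len z ≡ suc (bit (long z))
    len≡1+long z with long z in l
    ... | true  = len-long l
    ... | false = len-short l

    len≤2 : ∀ z → len z ≤ 2
    len≤2 z = subst (_≤ 2) (sym (len≡1+long z)) (s≤s (bit≤1 (long z)))

    AtOffsets : A → (ℕ → Set) → Set
    AtOffsets z P = P 0 × (long z ≡ true → P 1)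

    atOffsets? : ∀ z {P : ℕ → Set} → (∀ r → Dec (P r)) → Dec (AtOffsets z P)
    atOffsets? z P? = P? 0 ×-dec ((long z Bool.≟ true) →-dec P? 1)

    AtOffsets-all : ∀ z {P : ℕ → Set} → AtOffsets z P → ∀ r → r < len z → P r
    AtOffsets-all z     (P0 , _)  zero          _     = P0
    AtOffsets-all z {P} (_ , P1)  (suc zero)    r<len = by-length (long z) refl
      where
      by-length : ∀ t → long z ≡ t → P 1
      by-length true  l = P1 l
      by-length false l = contradiction (≤-trans r<len (≤-reflexive (len-short {z} l))) λ { (s≤s ()) }
    AtOffsets-all z     _         (suc (suc r)) r<len =
      contradiction (≤-trans r<len (len≤2 z)) λ { (s≤s (s≤s ())) }

    μ-z₀ : μ z₀ ≡ z₀ ∷ second z₀ ∷ []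
    μ-z₀ = trans (μ-shape z₀) (cong₂ (λ x t → x ∷ (if t then second z₀ ∷ [] else [])) first-z₀ long-z₀)
      where
      long-z₀ : long z₀ ≡ true
      long-z₀ = subst (λ x → long x ≡ true) first-z₀ (first-long z₀)

    pre : ℕ → List A
    pre m = iterate μ m (z₀ ∷ [])

    pre-suc : ∀ m → ∃ λ R → pre (suc m) ≡ pre m ++ R
    pre-suc zero    = second z₀ ∷ [] , trans (cong (_++ []) μ-z₀) (List.++-identityʳ _)
    pre-suc (suc m) with pre-suc m
    ... | R , e = concatMap μ R , trans (cong (concatMap μ) e) (List.concatMap-++ μ (pre m) R)

    pre-mono : ∀ {m m'} → m ≤ m' → ∃ λ R → pre m' ≡ pre m ++ R
    pre-mono {m} {m'} m≤m' = subst (λ k → ∃ λ R → pre k ≡ pre m ++ R) (m∸n+n≡m m≤m') (go (m' ∸ m))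
      where
      go : ∀ t → ∃ λ R → pre (t + m) ≡ pre m ++ R
      go zero    = [] , sym (List.++-identityʳ _)
      go (suc t) with go t | pre-suc (t + m)
      ... | R , e | R' , e' = R ++ R' , trans e' (trans (cong (_++ R') e) (List.++-assoc (pre m) R R'))

    pre-head : ∀ m → ∃ λ T → pre m ≡ z₀ ∷ T
    pre-head zero    = [] , refl
    pre-head (suc m) with pre-head m
    ... | T , e = second z₀ ∷ concatMap μ T , trans (cong (concatMap μ) e) (cong (_++ concatMap μ T) μ-z₀)

    length≤length-concatMap : ∀ xs → length xs ≤ length (concatMap μ xs)
    length≤length-concatMap []       = z≤n
    length≤length-concatMap (x ∷ xs) rewrite List.length-++ (μ x) {concatMap μ xs} =
      +-mono-≤ (subst (1 ≤_) (sym (len≡1+long x)) (s≤s z≤n)) (length≤length-concatMap xs)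

    length-pre : ∀ m → m < length (pre m)
    length-pre zero    = s≤s z≤n
    length-pre (suc m) with pre-head m
    ... | T , e rewrite e | μ-z₀ =
      s≤s (s≤s (≤-trans (≤-pred (subst (λ xs → suc m ≤ length xs) e (length-pre m))) (length≤length-concatMap T)))

    w-pre : ∀ m i → i < length (pre m) → nth z₀ (pre m) i ≡ w i
    w-pre m i i<n with ≤-total m (suc i)
    ... | inj₁ m≤ with pre-mono m≤
    ...   | R , e = sym (trans (cong (λ xs → nth z₀ xs i) e) (nth-++ˡ z₀ (pre m) R i<n))
    w-pre m i i<n | inj₂ ≤m with pre-mono ≤m
    ...   | R , e = trans (cong (λ xs → nth z₀ xs i) e) (nth-++ˡ z₀ (pre (suc i)) R (<-trans (n<1+n i) (length-pre (suc i))))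

    prefix : ℕ → List A
    prefix n = applyUpTo w n

    prefix-suc : ∀ j → prefix (suc j) ≡ prefix j ++ w j ∷ []
    prefix-suc j = sym (List.applyUpTo-∷ʳ w j)

    blocks : ℕ → List A
    blocks j = concatMap μ (prefix j)

    blockStart : ℕ → ℕ
    blockStart j = length (blocks j)

    blocks-suc : ∀ j → blocks (suc j) ≡ blocks j ++ μ (w j)
    blocks-suc j = trans (cong (concatMap μ) (prefix-suc j))
      (trans (List.concatMap-++ μ (prefix j) (w j ∷ [])) (cong (blocks j ++_) (List.++-identityʳ (μ (w j)))))

    blockStart-suc : ∀ j → blockStart (suc j) ≡ blockStart j + len (w j)
    blockStart-suc j = trans (cong length (blocks-suc j)) (List.length-++ (blocks j))

    blocks-agree : ∀ j i → i < blockStart j → nth z₀ (blocks j) i ≡ w i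
    blocks-agree j i i<b = begin
      nth z₀ (blocks j) i          ≡⟨ sym (nth-++ˡ z₀ (blocks j) (concatMap μ R) i<b) ⟩
      nth z₀ (blocks j ++ concatMap μ R) i ≡⟨ cong (λ xs → nth z₀ xs i) (sym pre-suc≡) ⟩
      nth z₀ (pre (suc j)) i                    ≡⟨ w-pre (suc j) i (subst (i <_) (cong length (sym pre-suc≡)) i<len) ⟩
      w i                                       ∎
      where
      open ≡-Reasoning
      R = drop j (pre j)
      pre-suc≡ : pre (suc j) ≡ blocks j ++ concatMap μ R
      pre-suc≡ = trans (cong (concatMap μ) (agree-split z₀ w (pre j) j (w-pre j) (<⇒≤ (length-pre j))))
                       (List.concatMap-++ μ (prefix j) R)
      i<len : i < length (blocks j ++ concatMap μ R)
      i<len = <-≤-trans i<b (List.length-++-≤ˡ (blocks j))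

    w-block : ∀ j r → r < len (w j) → w (blockStart j + r) ≡ nth z₀ (μ (w j)) r
    w-block j r r<len = begin
      w (blockStart j + r)                                           ≡⟨ sym (blocks-agree (suc j) _ in-block) ⟩
      nth z₀ (blocks (suc j)) (blockStart j + r)       ≡⟨ cong (λ xs → nth z₀ xs (blockStart j + r)) (blocks-suc j) ⟩
      nth z₀ (blocks j ++ μ (w j)) (blockStart j + r)  ≡⟨ nth-++ʳ z₀ (blocks j) (μ (w j)) r ⟩
      nth z₀ (μ (w j)) r                                             ∎
      where
      open ≡-Reasoning
      in-block : blockStart j + r < blockStart (suc j)
      in-block = subst (blockStart j + r <_) (sym (blockStart-suc j)) (+-monoʳ-< (blockStart j) r<len)

    w-zero : w 0 ≡ z₀
    w-zero = cong (λ xs → nth z₀ (xs ++ []) 0) μ-z₀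

    next : ℕ × Bool → ℕ × Bool
    next (j , false) = if long (w j) then (j , true) else (suc j , false)
    next (j , true)  = suc j , false

    -- locate k = (j , s): w k is letter number bit s of the block μ(w j)
    locate : ℕ → ℕ × Bool
    locate zero    = 0 , false
    locate (suc k) = next (locate k)

    parent : ℕ → ℕ
    parent k = proj₁ (locate k)

    inSecond : ℕ → Bool
    inSecond k = proj₂ (locate k)

    offset : ℕ → ℕ
    offset k = bit (inSecond k)

    data Next : ℕ × Bool → ℕ × Bool → Set where
      to-second    : ∀ {j} → long (w j) ≡ true  → Next (j , false) (j , true)
      after-second : ∀ {j} → Next (j , true) (suc j , false)
      after-short  : ∀ {j} → long (w j) ≡ false → Next (j , false) (suc j , false)

    next-view : ∀ p → Next p (next p)
    next-view (j , true)  = after-second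
    next-view (j , false) with long (w j) in l
    ... | true  = to-second l
    ... | false = after-short l

    InLongBlock : ℕ × Bool → Set
    InLongBlock (j , true)  = long (w j) ≡ true
    InLongBlock (j , false) = ⊤

    Next-inLongBlock : ∀ {p q} → Next p q → InLongBlock q
    Next-inLongBlock (to-second l)   = l
    Next-inLongBlock after-second    = tt
    Next-inLongBlock (after-short _) = tt

    locate-inLongBlock : ∀ k → InLongBlock (locate k)
    locate-inLongBlock zero    = tt
    locate-inLongBlock (suc k) = Next-inLongBlock (next-view (locate k))

    inSecond-long : ∀ k → inSecond k ≡ true → long (w (parent k)) ≡ true
    inSecond-long k e with locate k | locate-inLongBlock k
    ... | _ , true | l = l

    data StepFrom (p q : ℕ × Bool) : Set where
      in-block  : bit (proj₂ p) ≡ 0 → long (w (proj₁ p)) ≡ true →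
                  proj₁ q ≡ proj₁ p → bit (proj₂ q) ≡ 1 → StepFrom p q
      new-block : suc (bit (proj₂ p)) ≡ len (w (proj₁ p)) →
                  proj₁ q ≡ suc (proj₁ p) → bit (proj₂ q) ≡ 0 → StepFrom p q

    Next⇒StepFrom : ∀ {p q} → Next p q → InLongBlock p → StepFrom p q
    Next⇒StepFrom (to-second l)   _ = in-block refl l refl refl
    Next⇒StepFrom after-second    l = new-block (sym (len-long l)) refl refl
    Next⇒StepFrom (after-short l) _ = new-block (sym (len-short l)) refl refl

    Step : ℕ → Set
    Step k = StepFrom (locate k) (locate (suc k))

    step : ∀ k → Step k
    step k = Next⇒StepFrom (next-view (locate k)) (locate-inLongBlock k)

    offset<len : ∀ k → offset k < len (w (parent k))
    offset<len k with inSecond k in e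
    ... | true  = subst (1 <_) (sym (len-long (inSecond-long k e))) ≤-refl
    ... | false = subst (0 <_) (sym (len≡1+long (w (parent k)))) (s≤s z≤n)

    blockStart-locate : ∀ k → blockStart (parent k) + offset k ≡ k
    blockStart-locate zero    = refl
    blockStart-locate (suc k) with step k
    ... | in-block o≡0 _ p≡ o'≡1 = begin
      blockStart (parent (suc k)) + offset (suc k)  ≡⟨ cong₂ (λ j o → blockStart j + o) p≡ o'≡1 ⟩
      blockStart (parent k) + 1                     ≡⟨ +-suc _ 0 ⟩
      suc (blockStart (parent k) + 0)               ≡⟨ cong (λ o → suc (blockStart (parent k) + o)) (sym o≡0) ⟩
      suc (blockStart (parent k) + offset k)        ≡⟨ cong suc (blockStart-locate k) ⟩
      suc k                                         ∎
      where open ≡-Reasoning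
    ... | new-block o+1≡len p≡ o'≡0 = begin
      blockStart (parent (suc k)) + offset (suc k)  ≡⟨ cong₂ (λ j o → blockStart j + o) p≡ o'≡0 ⟩
      blockStart (suc (parent k)) + 0               ≡⟨ +-identityʳ _ ⟩
      blockStart (suc (parent k))                   ≡⟨ blockStart-suc (parent k) ⟩
      blockStart (parent k) + len (w (parent k))    ≡⟨ cong (blockStart (parent k) +_) (sym o+1≡len) ⟩
      blockStart (parent k) + suc (offset k)        ≡⟨ +-suc _ _ ⟩
      suc (blockStart (parent k) + offset k)        ≡⟨ cong suc (blockStart-locate k) ⟩
      suc k                                         ∎
      where open ≡-Reasoning

    w-locate : ∀ k → w k ≡ nth z₀ (μ (w (parent k))) (offset k)
    w-locate k = trans (cong w (sym (blockStart-locate k))) (w-block (parent k) (offset k) (offset<len k))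

    w-first : ∀ {k} → inSecond k ≡ false → w k ≡ first (w (parent k))
    w-first {k} e = trans (w-locate k) (cong (λ s → nth z₀ (μ (w (parent k))) (bit s)) e)

    w-second : ∀ {k} → inSecond k ≡ true → w k ≡ second (w (parent k))
    w-second {k} e = trans (w-locate k) (cong (λ s → nth z₀ (μ (w (parent k))) (bit s)) e)

    inSecond-w : ∀ k → inSecond k ≡ not (long (w k))
    inSecond-w k with inSecond k in e
    ... | false = cong not (sym (trans (cong long (w-first {k} e)) (first-long _)))
    ... | true  = cong not (sym (trans (cong long (w-second {k} e)) (second-short _ (inSecond-long k e))))

    offset+long : ∀ k → offset k + bit (long (w k)) ≡ 1
    offset+long k rewrite inSecond-w k with long (w k)
    ... | true  = refl
    ... | false = refl

    offset+len : ∀ k → offset k + len (w k) ≡ 2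
    offset+len k = trans (cong (offset k +_) (len≡1+long (w k))) (trans (+-suc _ _) (cong suc (offset+long k)))

    parent+offset-suc : ∀ k → parent (suc k) + offset (suc k) ≡ suc (parent k)
    parent+offset-suc k with step k
    ... | in-block _ _ p≡ o'≡1   = trans (cong₂ _+_ p≡ o'≡1) (+-comm (parent k) 1)
    ... | new-block _ p≡ o'≡0    = trans (cong₂ _+_ p≡ o'≡0) (+-identityʳ _)

    blockStart≡j+parent+offset : ∀ j → blockStart j ≡ j + (parent j + offset j)
    blockStart≡j+parent+offset zero    = refl
    blockStart≡j+parent+offset (suc j) = begin
      blockStart (suc j)
        ≡⟨ blockStart-suc j ⟩
      blockStart j + len (w j)
        ≡⟨ cong (_+ len (w j)) (blockStart≡j+parent+offset j) ⟩
      j + (parent j + offset j) + len (w j)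
        ≡⟨ solve 4 (λ j p o l → j :+ (p :+ o) :+ l := j :+ p :+ (o :+ l)) refl j (parent j) (offset j) (len (w j)) ⟩
      j + parent j + (offset j + len (w j))
        ≡⟨ cong (j + parent j +_) (offset+len j) ⟩
      j + parent j + 2
        ≡⟨ solve 2 (λ j p → j :+ p :+ con 2 := con 1 :+ j :+ (con 1 :+ p)) refl j (parent j) ⟩
      suc j + suc (parent j)
        ≡⟨ cong (suc j +_) (sym (parent+offset-suc j)) ⟩
      suc j + (parent (suc j) + offset (suc j)) ∎
      where open ≡-Reasoning

    suc<blockStart : ∀ j → suc j < blockStart (suc j)
    suc<blockStart j = subst (suc j <_) (sym (trans (blockStart≡j+parent+offset (suc j)) (cong (suc j +_) (parent+offset-suc j))))
                             (m<m+n (suc j) (s≤s z≤n))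

    parent< : ∀ {k} → 1 ≤ k → parent k < k
    parent< {k} 1≤k = go (parent k) refl
      where
      blockStart≤ : blockStart (parent k) ≤ k
      blockStart≤ = subst (blockStart (parent k) ≤_) (blockStart-locate k) (m≤m+n _ _)
      go : ∀ j → parent k ≡ j → j < k
      go zero    _ = 1≤k
      go (suc j) e = <-≤-trans (suc<blockStart j) (subst (λ i → blockStart i ≤ k) e blockStart≤)

    parent-suc : ∀ k → parent (suc k) ≡ parent k + bit (long (w (suc k)))
    parent-suc k = +-cancelʳ-≡ 1 _ _ (begin
      parent (suc k) + 1                                          ≡⟨ cong (parent (suc k) +_) (sym (offset+long (suc k))) ⟩
      parent (suc k) + (offset (suc k) + bit (long (w (suc k))))  ≡⟨ sym (+-assoc (parent (suc k)) _ _) ⟩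
      parent (suc k) + offset (suc k) + bit (long (w (suc k)))    ≡⟨ cong (_+ bit (long (w (suc k)))) (parent+offset-suc k) ⟩
      suc (parent k) + bit (long (w (suc k)))                     ≡⟨ +-comm 1 (parent k + bit (long (w (suc k)))) ⟩
      parent k + bit (long (w (suc k))) + 1                       ∎)
      where open ≡-Reasoning

    parent≤ : ∀ k → parent k ≤ k
    parent≤ zero    = z≤n
    parent≤ (suc k) = <⇒≤ (parent< (s≤s z≤n))

    k≡parent+grandparent : ∀ k → k ≡ parent k + (parent (parent k) + offset (parent k)) + offset k
    k≡parent+grandparent k = trans (sym (blockStart-locate k)) (cong (_+ offset k) (blockStart≡j+parent+offset (parent k)))

    blockStart-parent : ∀ n → blockStart n ≡ fibDigit 1 (inSecond n) + (blockStart (parent n) + parent n)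
    blockStart-parent n = begin
      blockStart n                                      ≡⟨ blockStart≡j+parent+offset n ⟩
      n + (parent n + offset n)                         ≡⟨ cong (_+ (parent n + offset n)) (sym (blockStart-locate n)) ⟩
      blockStart (parent n) + offset n + (parent n + offset n)
        ≡⟨ solve 3 (λ b p o → b :+ o :+ (p :+ o) := (o :+ o) :+ (b :+ p)) refl (blockStart (parent n)) (parent n) (offset n) ⟩
      (offset n + offset n) + (blockStart (parent n) + parent n)  ≡⟨ cong (_+ (blockStart (parent n) + parent n)) (double (inSecond n)) ⟩
      fibDigit 1 (inSecond n) + (blockStart (parent n) + parent n) ∎
      where
      open ≡-Reasoning
      double : ∀ s → bit s + bit s ≡ fibDigit 1 s
      double true  = refl
      double false = refl

    w-blockStart : ∀ n → w (blockStart n) ≡ first (w n)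
    w-blockStart n = trans (cong w (sym (+-identityʳ (blockStart n))))
                           (w-block n 0 (subst (0 <_) (sym (len≡1+long (w n))) (s≤s z≤n)))

    w-blockStart+1 : ∀ n → long (w n) ≡ true → w (suc (blockStart n)) ≡ second (w n)
    w-blockStart+1 n l = trans (cong w (+-comm 1 (blockStart n)))
                               (w-block n 1 (subst (1 <_) (sym (len-long l)) ≤-refl))

    μ-w : ∀ n → μ (w n) ≡ w (blockStart n) ∷ (if long (w n) then w (suc (blockStart n)) ∷ [] else [])
    μ-w n = trans (μ-shape (w n)) (cong₂ _∷_ (sym (w-blockStart n)) (rest (long (w n)) refl))
      where
      rest : ∀ t → long (w n) ≡ t →
        (if t then second (w n) ∷ [] else []) ≡ (if t then w (suc (blockStart n)) ∷ [] else [])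
      rest true  l = cong (_∷ []) (sym (w-blockStart+1 n l))
      rest false _ = refl

    -- the Fibonacci representation of n is that of its parent followed by the digit inSecond n
    record Representation (n : ℕ) : Set where
      field
        digits       : List Bool
        noLeading0   : NoLeading0 digits
        no11         : No11 digits
        val≡         : val digits ≡ n
        endsWith1≡   : endsWith1 digits ≡ inSecond n
        shiftedVal≡  : shiftedVal digits ≡ blockStart n

    representation : ∀ n → Representation n
    representation = <-rec Representation go
      where
      go : ∀ n → (∀ {m} → m < n → Representation m) → Representation n
      go zero    _   = record { digits = [] ; noLeading0 = tt ; no11 = tt ; val≡ = refl
                              ; endsWith1≡ = refl ; shiftedVal≡ = refl }
      go (suc m) rec = record
        { digits      = R.digits ++ s ∷ []
        ; noLeading0  = NoLeading0-snoc R.digits s R.noLeading0 empty⇒second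
        ; no11        = No11-snoc R.digits s R.no11 (λ e → trans R.endsWith1≡ (parent-first e))
        ; val≡        = trans (val-snoc R.digits s)
                          (trans (cong (offset n +_) R.shiftedVal≡) (trans (+-comm (offset n) _) (blockStart-locate n)))
        ; endsWith1≡  = endsWith1-snoc R.digits s
        ; shiftedVal≡ = trans (shiftedVal-snoc R.digits s)
                          (trans (cong (λ t → fibDigit 1 s + t) (cong₂ _+_ R.shiftedVal≡ R.val≡)) (sym (blockStart-parent n)))
        }
        where
        n = suc m
        s = inSecond n
        module R = Representation (rec (parent< (s≤s z≤n)))
        parent-first : s ≡ true → inSecond (parent n) ≡ false
        parent-first e = trans (inSecond-w (parent n)) (cong not (inSecond-long n e))
        empty⇒second : R.digits ≡ [] → s ≡ true
        empty⇒second e = bit≡suc (trans (cong (λ j → blockStart j + offset n) (sym parent≡0)) (blockStart-locate n))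
          where
          parent≡0 : parent n ≡ 0
          parent≡0 = trans (sym R.val≡) (cong val e)
          bit≡suc : ∀ {t} → bit t ≡ n → t ≡ true
          bit≡suc {true} _ = refl

    repF≡digits : ∀ n → repF n ≡ Representation.digits (representation n)
    repF≡digits n = trans (cong repF (sym R.val≡)) (repF-val R.digits R.noLeading0 R.no11)
      where module R = Representation (representation n)

    PhiCondition : ℕ → List Bool → Set
    PhiCondition n u =
      if endsWith1 u
      then μ (w n) ≡ w (val (u ++ false ∷ [])) ∷ []
      else μ (w n) ≡ w (val (u ++ false ∷ [])) ∷ w (val (u ++ true ∷ [])) ∷ []

    phiCondition : ∀ n u → endsWith1 u ≡ inSecond n → shiftedVal u ≡ blockStart n → PhiCondition n u
    phiCondition n u e v rewrite e | inSecond-w n | val-snoc u false | val-snoc u true | v =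
      by-length (long (w n)) (μ-w n)
      where
      by-length : ∀ t {xs : List A} {y z} → xs ≡ y ∷ (if t then z ∷ [] else []) →
                  if not t then xs ≡ y ∷ [] else xs ≡ y ∷ z ∷ []
      by-length true  e = e
      by-length false e = e

    isPhiMorphism : IsPhiMorphism μ w
    isPhiMorphism n = subst (PhiCondition n) (sym (repF≡digits n)) (phiCondition n R.digits R.endsWith1≡ R.shiftedVal≡)
      where module R = Representation (representation n)

    History : Set
    History = Maybe A × Maybe A × Maybe A

    Window : Set
    Window = History × A

    lookback : ℕ → ℕ → Maybe A
    lookback j       zero    = just (w j)
    lookback zero    (suc d) = nothing
    lookback (suc j) (suc d) = lookback j d

    history : ℕ → History
    history j = lookback j 3 , lookback j 2 , lookback j 1

    window : ℕ → Window
    window j = history j , w j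

    lookback-just : ∀ j d {q} → lookback j d ≡ just q → ∃ λ p → j ≡ d + p × w p ≡ q
    lookback-just j       zero    refl = j , refl , refl
    lookback-just (suc j) (suc d) e with lookback-just j d e
    ... | p , j≡d+p , w≡q = p , cong suc j≡d+p , w≡q

    push : History → Maybe A → History
    push (_ , y , z) t = y , z , t

    pushAll : History → List (Maybe A) → History
    pushAll = foldl push

    blank : History
    blank = nothing , nothing , nothing

    images : Maybe A → List (Maybe A)
    images nothing  = nothing ∷ []
    images (just x) = map just (μ x)

    imagesOf : History → List (Maybe A)
    imagesOf (m₀ , m₁ , m₂) = images m₀ ++ images m₁ ++ images m₂

    -- each image is nonempty, so the images of the three letters before z cover the history
    -- of every letter of μ(z)
    childWindow : Window → ℕ → Window
    childWindow (h , z) r = pushAll blank (imagesOf h ++ map just (take r (μ z))) , nth z₀ (μ z) r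

    pushAll-last3 : ∀ h h' xs → 3 ≤ length xs → pushAll h xs ≡ pushAll h' xs
    pushAll-last3 h h' (x ∷ y ∷ z ∷ [])     _                   = refl
    pushAll-last3 h h' (x ∷ [])             (s≤s ())
    pushAll-last3 h h' (x ∷ y ∷ [])         (s≤s (s≤s ()))
    pushAll-last3 h h' (x ∷ y ∷ z ∷ t ∷ xs) _                   =
      pushAll-last3 (push h x) (push h' x) (y ∷ z ∷ t ∷ xs) (s≤s (s≤s (s≤s z≤n)))

    images-nonempty : ∀ m → 1 ≤ length (images m)
    images-nonempty nothing  = s≤s z≤n
    images-nonempty (just x) rewrite List.length-map just (μ x) | len≡1+long x = s≤s z≤n

    3≤length-imagesOf : ∀ h → 3 ≤ length (imagesOf h)
    3≤length-imagesOf (m₀ , m₁ , m₂)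
      rewrite List.length-++ (images m₀) {images m₁ ++ images m₂} | List.length-++ (images m₁) {images m₂} =
      +-mono-≤ (images-nonempty m₀) (+-mono-≤ (images-nonempty m₁) (images-nonempty m₂))

    take-suc-nth : ∀ (xs : List A) r → r < length xs → take (suc r) xs ≡ take r xs ++ nth z₀ xs r ∷ []
    take-suc-nth (x ∷ xs) zero    _         = refl
    take-suc-nth (x ∷ xs) (suc r) (s≤s r<n) = cong (x ∷_) (take-suc-nth xs r r<n)

    shift-history : ∀ m₀ m₁ m₂ z →
      pushAll blank (imagesOf (m₀ , m₁ , m₂) ++ map just (μ z)) ≡ pushAll blank (imagesOf (m₁ , m₂ , just z) ++ [])
    shift-history m₀ m₁ m₂ z = begin
      pushAll blank ((images m₀ ++ images m₁ ++ images m₂) ++ map just (μ z))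
        ≡⟨ cong (pushAll blank) (List.++-assoc (images m₀) _ _) ⟩
      pushAll blank (images m₀ ++ ((images m₁ ++ images m₂) ++ map just (μ z)))
        ≡⟨ cong (λ ys → pushAll blank (images m₀ ++ ys)) (List.++-assoc (images m₁) _ _) ⟩
      pushAll blank (images m₀ ++ imagesOf (m₁ , m₂ , just z))
        ≡⟨ List.foldl-++ push blank (images m₀) (imagesOf (m₁ , m₂ , just z)) ⟩
      pushAll (pushAll blank (images m₀)) (imagesOf (m₁ , m₂ , just z))
        ≡⟨ pushAll-last3 (pushAll blank (images m₀)) blank (imagesOf (m₁ , m₂ , just z))
                         (3≤length-imagesOf (m₁ , m₂ , just z)) ⟩
      pushAll blank (imagesOf (m₁ , m₂ , just z))
        ≡⟨ cong (pushAll blank) (sym (List.++-identityʳ (imagesOf (m₁ , m₂ , just z)))) ⟩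
      pushAll blank (imagesOf (m₁ , m₂ , just z) ++ []) ∎
      where open ≡-Reasoning

    childHistory : ℕ → ℕ → History
    childHistory j r = proj₁ (childWindow (window j) r)

    history-grow : ∀ k → history k ≡ childHistory (parent k) (offset k) →
                   history (suc k) ≡ childHistory (parent k) (suc (offset k))
    history-grow k ih = begin
      push (history k) (just (w k))
        ≡⟨ cong₂ push ih (cong just (w-locate k)) ⟩
      push (pushAll blank (imagesOf h ++ map just (take o (μ z)))) (just (nth z₀ (μ z) o))
        ≡⟨ sym (List.foldl-∷ʳ push blank (just (nth z₀ (μ z) o)) (imagesOf h ++ map just (take o (μ z)))) ⟩
      pushAll blank ((imagesOf h ++ map just (take o (μ z))) ++ just (nth z₀ (μ z) o) ∷ [])
        ≡⟨ cong (pushAll blank) (List.++-assoc (imagesOf h) (map just (take o (μ z))) _) ⟩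
      pushAll blank (imagesOf h ++ map just (take o (μ z)) ++ just (nth z₀ (μ z) o) ∷ [])
        ≡⟨ cong (λ ys → pushAll blank (imagesOf h ++ ys)) (sym extend) ⟩
      pushAll blank (imagesOf h ++ map just (take (suc o) (μ z))) ∎
      where
      open ≡-Reasoning
      o = offset k
      z = w (parent k)
      h = history (parent k)
      extend : map just (take (suc o) (μ z)) ≡ map just (take o (μ z)) ++ just (nth z₀ (μ z) o) ∷ []
      extend = trans (cong (map just) (take-suc-nth (μ z) o (offset<len k))) (List.map-++ just (take o (μ z)) _)

    history-parent : ∀ k → history k ≡ childHistory (parent k) (offset k)
    history-parent zero    = refl
    history-parent (suc k) with step k
    ... | in-block o≡0 _ p≡ o'≡1 =
      trans (history-grow k (history-parent k)) (cong₂ childHistory (sym p≡) (trans (cong suc o≡0) (sym o'≡1)))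
    ... | new-block o+1≡len p≡ o'≡0 = begin
      history (suc k)
        ≡⟨ history-grow k (history-parent k) ⟩
      pushAll blank (imagesOf (history p) ++ map just (take (suc (offset k)) (μ (w p))))
        ≡⟨ cong (λ ys → pushAll blank (imagesOf (history p) ++ map just ys))
                (List.take-all _ (μ (w p)) (≤-reflexive (sym o+1≡len))) ⟩
      pushAll blank (imagesOf (history p) ++ map just (μ (w p)))
        ≡⟨ shift-history (lookback p 3) (lookback p 2) (lookback p 1) (w p) ⟩
      childHistory (suc p) 0
        ≡⟨ cong₂ childHistory (sym p≡) (sym o'≡0) ⟩
      childHistory (parent (suc k)) (offset (suc k)) ∎
      where
      open ≡-Reasoning
      p = parent k

    window-parent : ∀ k → window k ≡ childWindow (window (parent k)) (offset k)
    window-parent k = cong₂ _,_ (history-parent k) (w-locate k)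

    windows-within : (L : List Window) → window 0 ∈ L →
      (∀ {W} → W ∈ L → ∀ r → r < len (proj₂ W) → childWindow W r ∈ L) → ∀ j → window j ∈ L
    windows-within L window₀∈L closed = <-rec (λ j → window j ∈ L) go
      where
      go : ∀ j → (∀ {i} → i < j → window i ∈ L) → window j ∈ L
      go zero    _   = window₀∈L
      go (suc j) rec = subst (_∈ L) (sym (window-parent (suc j)))
                         (closed (rec (parent< (s≤s z≤n))) (offset (suc j)) (offset<len (suc j)))

-- The morphism f₃

open Morphism f3 (# 0)

opaque
  f3-shape : ∀ z → f3 z ≡ first z ∷ (if long z then second z ∷ [] else [])
  f3-shape = from-yes (Fin.all? λ z → List.≡-dec Fin._≟_ (f3 z) (first z ∷ (if long z then second z ∷ [] else [])))

  f3-first-long : ∀ z → long (first z) ≡ true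
  f3-first-long = from-yes (Fin.all? λ z → long (first z) Bool.≟ true)

  f3-second-short : ∀ z → long z ≡ true → long (second z) ≡ false
  f3-second-short = from-yes (Fin.all? λ z → (long z Bool.≟ true) →-dec (long (second z) Bool.≟ false))

open FibonacciType f3-shape f3-first-long f3-second-short refl

open Occurrences (g3 ∘ w)

isA : AB → ℕ
isA d = if d ≟AB a then 1 else 0

-- chosen so that count a k ≡ parent k + aCorrection (w k)
aCorrection : Letter → ℕ
aCorrection z = lookup table z
  where
  table : Vec ℕ 22
  table = 0 ∷ᵥ 1 ∷ᵥ 1 ∷ᵥ 1 ∷ᵥ 2 ∷ᵥ 1 ∷ᵥ 2 ∷ᵥ 1 ∷ᵥ 1 ∷ᵥ 1 ∷ᵥ 1 ∷ᵥ
          0 ∷ᵥ 1 ∷ᵥ 1 ∷ᵥ 1 ∷ᵥ 1 ∷ᵥ 1 ∷ᵥ 2 ∷ᵥ 1 ∷ᵥ 1 ∷ᵥ 2 ∷ᵥ 1 ∷ᵥ []ᵥ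

lastLetter : Letter → Letter
lastLetter z = nth (# 0) (f3 z) (len z ∸ 1)

opaque
  aCorrection-second : ∀ z → long z ≡ true → aCorrection (second z) ≡ aCorrection (first z) + isA (g3 (first z))
  aCorrection-second = from-yes (Fin.all? λ z →
    (long z Bool.≟ true) →-dec (aCorrection (second z) ≟ aCorrection (first z) + isA (g3 (first z))))

  aCorrection≤2 : ∀ z → aCorrection z ≤ 2
  aCorrection≤2 = from-yes (Fin.all? λ z → aCorrection z ≤? 2)

f3-windows : List Window
f3-windows =
    ((nothing , nothing , nothing) , # 0)
  ∷ ((nothing , nothing , just (# 0)) , # 1)
  ∷ ((nothing , just (# 0) , just (# 1)) , # 2)
  ∷ ((just (# 0) , just (# 1) , just (# 2)) , # 3)
  ∷ ((just (# 1) , just (# 2) , just (# 3)) , # 4)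
  ∷ ((just (# 4) , just (# 5) , just (# 6)) , # 7)
  ∷ ((just (# 8) , just (# 9) , just (# 10)) , # 11)
  ∷ ((just (# 9) , just (# 10) , just (# 11)) , # 12)
  ∷ ((just (# 16) , just (# 14) , just (# 17)) , # 18)
  ∷ ((just (# 19) , just (# 12) , just (# 18)) , # 13)
  ∷ ((just (# 12) , just (# 18) , just (# 13)) , # 12)
  ∷ ((just (# 12) , just (# 14) , just (# 17)) , # 18)
  ∷ ((just (# 18) , just (# 13) , just (# 12)) , # 14)
  ∷ ((just (# 13) , just (# 12) , just (# 14)) , # 17)
  ∷ ((just (# 18) , just (# 19) , just (# 12)) , # 18)
  ∷ ((just (# 14) , just (# 17) , just (# 18)) , # 19)
  ∷ ((just (# 17) , just (# 18) , just (# 19)) , # 12)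
  ∷ ((just (# 12) , just (# 19) , just (# 12)) , # 18)
  ∷ ((just (# 18) , just (# 13) , just (# 12)) , # 19)
  ∷ ((just (# 13) , just (# 12) , just (# 19)) , # 12)
  ∷ ((just (# 14) , just (# 15) , just (# 16)) , # 14)
  ∷ ((just (# 15) , just (# 16) , just (# 14)) , # 17)
  ∷ ((just (# 21) , just (# 19) , just (# 12)) , # 18)
  ∷ ((just (# 18) , just (# 20) , just (# 21)) , # 19)
  ∷ ((just (# 20) , just (# 21) , just (# 19)) , # 12)
  ∷ ((just (# 16) , just (# 19) , just (# 12)) , # 18)
  ∷ ((just (# 14) , just (# 15) , just (# 16)) , # 19)
  ∷ ((just (# 15) , just (# 16) , just (# 19)) , # 12)
  ∷ ((just (# 2) , just (# 3) , just (# 4)) , # 5)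
  ∷ ((just (# 3) , just (# 4) , just (# 5)) , # 6)
  ∷ ((just (# 7) , just (# 8) , just (# 9)) , # 10)
  ∷ ((just (# 13) , just (# 12) , just (# 14)) , # 15)
  ∷ ((just (# 12) , just (# 14) , just (# 15)) , # 16)
  ∷ ((just (# 12) , just (# 18) , just (# 20)) , # 21)
  ∷ ((just (# 19) , just (# 12) , just (# 18)) , # 20)
  ∷ ((just (# 5) , just (# 6) , just (# 7)) , # 8)
  ∷ ((just (# 6) , just (# 7) , just (# 8)) , # 9)
  ∷ ((just (# 12) , just (# 13) , just (# 12)) , # 14)
  ∷ ((just (# 10) , just (# 11) , just (# 12)) , # 13)
  ∷ ((just (# 11) , just (# 12) , just (# 13)) , # 12)
  ∷ ((just (# 18) , just (# 14) , just (# 17)) , # 18)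
  ∷ ((just (# 14) , just (# 17) , just (# 18)) , # 14)
  ∷ ((just (# 17) , just (# 18) , just (# 14)) , # 17)
  ∷ []

_≟W_ : DecidableEquality Window
_≟W_ = Product.≡-dec (Product.≡-dec _≟ₘ_ (Product.≡-dec _≟ₘ_ _≟ₘ_)) Fin._≟_
  where
  _≟ₘ_ : DecidableEquality (Maybe Letter)
  _≟ₘ_ = Maybe.≡-dec Fin._≟_

open import Data.List.Membership.DecPropositional _≟W_ using (_∈?_)

AdjacentCounts : Window → Set
AdjacentCounts ((_ , _ , nothing) , _) = ⊤
AdjacentCounts ((_ , _ , just z)  , y) =
  suc (aCorrection (first y)) ≡ aCorrection (lastLetter z) + isA (g3 (lastLetter z))

adjacentCounts? : ∀ W → Dec (AdjacentCounts W)
adjacentCounts? ((_ , _ , nothing) , _) = yes tt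
adjacentCounts? ((_ , _ , just z)  , y) =
  suc (aCorrection (first y)) ≟ aCorrection (lastLetter z) + isA (g3 (lastLetter z))

_≟ᴬᴮ_ : DecidableEquality AB
a ≟ᴬᴮ a = yes refl
b ≟ᴬᴮ b = yes refl
a ≟ᴬᴮ b = no λ ()
b ≟ᴬᴮ a = no λ ()

bitLong : Maybe Letter → ℕ
bitLong nothing  = 0
bitLong (just z) = bit (long z)

PartnerAt : Maybe Letter → ℕ → ℕ → Set
PartnerAt nothing  _ _ = ⊥
PartnerAt (just q) c n = g3 q ≡ a × aCorrection q + c ≡ n

partnerAt? : ∀ m c n → Dec (PartnerAt m c n)
partnerAt? nothing  _ _ = no λ ()
partnerAt? (just q) c n = (g3 q ≟ᴬᴮ a) ×-dec (aCorrection q + c ≟ n)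

-- a b at offset r of the block of z is paired with the a two or three letters
-- before z, according to its a-correction
Partner : Window → ℕ → Set
Partner ((m₀ , m₁ , m₂) , z) r =
    (aCorrection y ≡ 2 × PartnerAt m₁ 2 (1 + bitLong m₂ + r))
  ⊎ (aCorrection y ≡ 1 × PartnerAt m₀ 1 (1 + (bitLong m₁ + bitLong m₂) + r))
  where y = nth (# 0) (f3 z) r

partner? : ∀ W r → Dec (Partner W r)
partner? ((m₀ , m₁ , m₂) , z) r =
      (aCorrection y ≟ 2 ×-dec partnerAt? m₁ 2 (1 + bitLong m₂ + r))
  ⊎-dec (aCorrection y ≟ 1 ×-dec partnerAt? m₀ 1 (1 + (bitLong m₁ + bitLong m₂) + r))
  where y = nth (# 0) (f3 z) r

ChildrenListed : Window → Set
ChildrenListed W = AtOffsets (proj₂ W) (λ r → childWindow W r ∈ f3-windows)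

BPartnered : Window → ℕ → Set
BPartnered W r = g3 (nth (# 0) (f3 (proj₂ W)) r) ≡ b → Partner W r

BChildrenPartnered : Window → Set
BChildrenPartnered W = AtOffsets (proj₂ W) (BPartnered W)

opaque
  f3-windows-closed : All ChildrenListed f3-windows
  f3-windows-closed = from-yes (All.all? (λ W → atOffsets? (proj₂ W) (λ r → childWindow W r ∈? f3-windows)) f3-windows)

  f3-windows-adjacent : All AdjacentCounts f3-windows
  f3-windows-adjacent = from-yes (All.all? adjacentCounts? f3-windows)

  f3-windows-partnered : All BChildrenPartnered f3-windows
  f3-windows-partnered = from-yes (All.all? (λ W → atOffsets? (proj₂ W) (λ r →
    (g3 (nth (# 0) (f3 (proj₂ W)) r) ≟ᴬᴮ b) →-dec partner? W r)) f3-windows)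

window-listed : ∀ j → window j ∈ f3-windows
window-listed = windows-within f3-windows (here (cong (blank ,_) w-zero))
  (λ {W} W∈ → AtOffsets-all (proj₂ W) (All.lookup f3-windows-closed W∈))

every-window : ∀ {P : Window → Set} → All P f3-windows → ∀ j → P (window j)
every-window all j = All.lookup all (window-listed j)

count-a≡parent+aCorrection : ∀ k → count a k ≡ parent k + aCorrection (w k)
count-a≡parent+aCorrection zero    = cong aCorrection (sym w-zero)
count-a≡parent+aCorrection (suc k) with step k
... | in-block o≡0 l p≡ o'≡1 = begin
  count a k + isA (g3 (w k))                           ≡⟨ cong (_+ isA (g3 (w k))) (count-a≡parent+aCorrection k) ⟩
  parent k + aCorrection (w k) + isA (g3 (w k))        ≡⟨ +-assoc (parent k) _ _ ⟩
  parent k + (aCorrection (w k) + isA (g3 (w k)))      ≡⟨ cong (λ y → parent k + (aCorrection y + isA (g3 y))) w≡first ⟩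
  parent k + (aCorrection (first z) + isA (g3 (first z))) ≡⟨ cong (parent k +_) (sym (aCorrection-second z l)) ⟩
  parent k + aCorrection (second z)                    ≡⟨ cong₂ (λ j y → j + aCorrection y) (sym p≡) (sym w'≡second) ⟩
  parent (suc k) + aCorrection (w (suc k))             ∎
  where
  open ≡-Reasoning
  z = w (parent k)
  w≡first : w k ≡ first z
  w≡first = trans (w-locate k) (cong (nth (# 0) (f3 z)) o≡0)
  w'≡second : w (suc k) ≡ second z
  w'≡second = trans (w-locate (suc k)) (cong₂ (λ j r → nth (# 0) (f3 (w j)) r) p≡ o'≡1)
... | new-block o+1≡len p≡ o'≡0 = begin
  count a k + isA (g3 (w k))                           ≡⟨ cong (_+ isA (g3 (w k))) (count-a≡parent+aCorrection k) ⟩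
  parent k + aCorrection (w k) + isA (g3 (w k))        ≡⟨ +-assoc (parent k) _ _ ⟩
  parent k + (aCorrection (w k) + isA (g3 (w k)))      ≡⟨ cong (λ y → parent k + (aCorrection y + isA (g3 y))) w≡last ⟩
  parent k + (aCorrection (lastLetter z) + isA (g3 (lastLetter z)))
    ≡⟨ cong (parent k +_) (sym (every-window f3-windows-adjacent (suc (parent k)))) ⟩
  parent k + suc (aCorrection (first z'))              ≡⟨ +-suc (parent k) _ ⟩
  suc (parent k) + aCorrection (first z')              ≡⟨ cong₂ (λ j y → j + aCorrection y) (sym p≡) (sym w'≡first) ⟩
  parent (suc k) + aCorrection (w (suc k))             ∎
  where
  open ≡-Reasoning
  z = w (parent k)
  z' = w (suc (parent k))
  w≡last : w k ≡ lastLetter z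
  w≡last = trans (w-locate k) (cong (λ n → nth (# 0) (f3 z) (n ∸ 1)) o+1≡len)
  w'≡first : w (suc k) ≡ first z'
  w'≡first = trans (w-locate (suc k)) (cong₂ (λ j r → nth (# 0) (f3 (w j)) r) p≡ o'≡0)

PartnerOf : ℕ → Set
PartnerOf k = ∃ λ p → count a k ≡ p + 4 × g3 (w p) ≡ a × count a p + count a k ≡ k

partnerOf-intro : ∀ k d p L → parent k ≡ suc d + p → aCorrection (w k) + suc d ≡ 4 → g3 (w p) ≡ a →
  parent (parent k) ≡ parent p + L + bit (long (w (parent k))) →
  aCorrection (w p) + aCorrection (w k) ≡ 1 + L + offset k → PartnerOf k
partnerOf-intro k d p L P≡ c+d≡4 gp PP≡ c+c≡ = p , count-a-k , gp , sum≡k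
  where
  open ≡-Reasoning
  P = parent k
  count-a-k : count a k ≡ p + 4
  count-a-k = begin
    count a k                        ≡⟨ count-a≡parent+aCorrection k ⟩
    P + aCorrection (w k)            ≡⟨ cong (_+ aCorrection (w k)) P≡ ⟩
    suc d + p + aCorrection (w k)    ≡⟨ solve 3 (λ d p c → d :+ p :+ c := p :+ (c :+ d)) refl (suc d) p (aCorrection (w k)) ⟩
    p + (aCorrection (w k) + suc d)  ≡⟨ cong (p +_) c+d≡4 ⟩
    p + 4                            ∎
  sum≡k : count a p + count a k ≡ k
  sum≡k = begin
    count a p + count a k
      ≡⟨ cong₂ _+_ (count-a≡parent+aCorrection p) (count-a≡parent+aCorrection k) ⟩
    parent p + aCorrection (w p) + (P + aCorrection (w k))
      ≡⟨ solve 4 (λ pp cp pk ck → pp :+ cp :+ (pk :+ ck) := pk :+ pp :+ (cp :+ ck)) refl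
           (parent p) (aCorrection (w p)) P (aCorrection (w k)) ⟩
    P + parent p + (aCorrection (w p) + aCorrection (w k))
      ≡⟨ cong (P + parent p +_) c+c≡ ⟩
    P + parent p + (1 + L + offset k)
      ≡⟨ cong (λ t → P + parent p + (t + L + offset k)) (sym (offset+long P)) ⟩
    P + parent p + (offset P + bit (long (w P)) + L + offset k)
      ≡⟨ solve 6 (λ pk pp oP lb l o → pk :+ pp :+ (oP :+ lb :+ l :+ o) := pk :+ (pp :+ l :+ lb :+ oP) :+ o) refl
           P (parent p) (offset P) (bit (long (w P))) L (offset k) ⟩
    P + (parent p + L + bit (long (w P)) + offset P) + offset k
      ≡⟨ cong (λ t → P + (t + offset P) + offset k) (sym PP≡) ⟩
    P + (parent P + offset P) + offset k
      ≡⟨ sym (k≡parent+grandparent k) ⟩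
    k ∎

PartnerAt-just : ∀ m {c n} → PartnerAt m c n → ∃ λ q → m ≡ just q × g3 q ≡ a × aCorrection q + c ≡ n
PartnerAt-just (just q) (g , e) = q , refl , g , e

longBit : ℕ → ℕ
longBit i = bit (long (w i))

partner-of-b : ∀ k → g3 (w k) ≡ b → PartnerOf k
partner-of-b k gb =
  by-case (AtOffsets-all (w P) {BPartnered (window P)} (every-window f3-windows-partnered P) (offset k) (offset<len k)
            (trans (cong g3 (sym (w-locate k))) gb))
  where
  P = parent k
  aC≡ : aCorrection (nth (# 0) (f3 (w P)) (offset k)) ≡ aCorrection (w k)
  aC≡ = cong aCorrection (sym (w-locate k))
  by-case : Partner (window P) (offset k) → PartnerOf k
  by-case (inj₁ (c≡2 , pa)) with PartnerAt-just (lookback P 2) pa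
  ... | q , m≡q , gq , e with lookback-just P 2 m≡q
  ...   | p , P≡ , wp≡q =
    partnerOf-intro k 1 p (longBit (suc p)) P≡ (cong (_+ 2) c≡) (trans (cong g3 wp≡q) gq) PP≡
      (trans (cong₂ _+_ (cong aCorrection wp≡q) c≡) (trans e (cong (λ j → 1 + bitLong (lookback j 1) + offset k) P≡)))
    where
    c≡ : aCorrection (w k) ≡ 2
    c≡ = trans (sym aC≡) c≡2
    PP≡ : parent P ≡ parent p + longBit (suc p) + longBit P
    PP≡ = trans (cong parent P≡) (trans (parent-suc (suc p)) (cong₂ _+_ (parent-suc p) (cong longBit (sym P≡))))
  by-case (inj₂ (c≡1 , pa)) with PartnerAt-just (lookback P 3) pa
  ... | q , m≡q , gq , e with lookback-just P 3 m≡q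
  ...   | p , P≡ , wp≡q =
    partnerOf-intro k 2 p (longBit (suc p) + longBit (2 + p)) P≡ (cong (_+ 3) c≡) (trans (cong g3 wp≡q) gq) PP≡
      (trans (cong₂ _+_ (cong aCorrection wp≡q) c≡)
        (trans e (cong (λ j → 1 + (bitLong (lookback j 2) + bitLong (lookback j 1)) + offset k) P≡)))
    where
    c≡ : aCorrection (w k) ≡ 1
    c≡ = trans (sym aC≡) c≡1
    PP≡ : parent P ≡ parent p + (longBit (suc p) + longBit (2 + p)) + longBit P
    PP≡ = trans (cong parent P≡) (trans (parent-suc (2 + p)) (cong₂ _+_
            (trans (parent-suc (suc p)) (trans (cong (_+ longBit (2 + p)) (parent-suc p)) (+-assoc (parent p) _ _)))
            (cong longBit (sym P≡))))

-- parent k ≈ k/φ, so about k/φ² of the first k letters are b's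
count-b-linear : ∀ k → k ≤ 3 * count b k + 10
count-b-linear k = begin
  k                                   ≡⟨ k≡parent+grandparent k ⟩
  p + (q + offset p) + offset k       ≡⟨ cong (λ t → t + (q + offset p) + offset k) (k≡parent+grandparent p) ⟩
  q + (parent q + offset q) + offset p + (q + offset p) + offset k
    ≤⟨ +-mono-≤ (+-mono-≤ (+-mono-≤ (+-monoʳ-≤ q (+-mono-≤ (parent≤ q) (bit≤1 (inSecond q)))) (bit≤1 (inSecond p)))
                           (+-monoʳ-≤ q (bit≤1 (inSecond p)))) (bit≤1 (inSecond k)) ⟩
  q + (q + 1) + 1 + (q + 1) + 1       ≡⟨ solve 1 (λ q → q :+ (q :+ con 1) :+ con 1 :+ (q :+ con 1) :+ con 1 := con 3 :* q :+ con 4) refl q ⟩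
  3 * q + 4                           ≤⟨ +-monoˡ-≤ 4 (*-monoʳ-≤ 3 q≤) ⟩
  3 * (count b k + 2) + 4             ≡⟨ solve 1 (λ c → con 3 :* (c :+ con 2) :+ con 4 := con 3 :* c :+ con 10) refl (count b k) ⟩
  3 * count b k + 10                  ∎
  where
  open ≤-Reasoning
  p = parent k
  q = parent p
  split : p + (q + (offset p + offset k)) ≡ p + (count b k + aCorrection (w k))
  split = begin-equality
    p + (q + (offset p + offset k))    ≡⟨ solve 4 (λ p q o o' → p :+ (q :+ (o :+ o')) := p :+ (q :+ o) :+ o') refl p q (offset p) (offset k) ⟩
    p + (q + offset p) + offset k      ≡⟨ sym (k≡parent+grandparent k) ⟩
    k                                  ≡⟨ sym (count-a+b k) ⟩
    count a k + count b k              ≡⟨ cong (_+ count b k) (count-a≡parent+aCorrection k) ⟩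
    p + aCorrection (w k) + count b k  ≡⟨ solve 3 (λ p c n → p :+ c :+ n := p :+ (n :+ c)) refl p (aCorrection (w k)) (count b k) ⟩
    p + (count b k + aCorrection (w k)) ∎
  q≤ : q ≤ count b k + 2
  q≤ = begin
    q                                  ≤⟨ m≤m+n q _ ⟩
    q + (offset p + offset k)          ≡⟨ +-cancelˡ-≡ p _ _ split ⟩
    count b k + aCorrection (w k)      ≤⟨ +-monoʳ-≤ (count b k) (aCorrection≤2 (w k)) ⟩
    count b k + 2                      ∎

open PairPositions 3 (g3 ∘ w)

count-b-unbounded : ∀ n → n < count b (3 * suc n + 10)
count-b-unbounded n =
  *-cancelˡ-≤ 3 (+-cancelʳ-≤ 10 (3 * suc n) (3 * count b K) (count-b-linear K))
  where K = 3 * suc n + 10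

pairing : ∀ n → GappedPair n
pairing n = from-b (occurrence-below b (3 * suc n + 10) (count-b-unbounded n))
  where
  from-b : (∃ λ k → g3 (w k) ≡ b × count b k ≡ n) → GappedPair n
  from-b (k , gk , ck) = from-partner (partner-of-b k gk)
    where
    from-partner : PartnerOf k → GappedPair n
    from-partner (p , ak , gp , sum≡k) =
      4 + p , 4 + k , (s≤s (s≤s (s≤s (s≤s z≤n))) , gp , ap) , (s≤s (s≤s (s≤s (s≤s z≤n))) , gk , ck) , gap
      where
      ap : count a p ≡ n
      ap = trans (+-cancelʳ-≡ (count a k) (count a p) (count b k)
                   (trans sum≡k (trans (sym (count-a+b k)) (+-comm (count a k) (count b k))))) ck
      gap : 4 + k ≡ 4 + p + n + 4
      gap = cong (4 +_) (trans (sym sum≡k) (trans (cong₂ _+_ ap ak) (solve 2 (λ n p → n :+ (p :+ con 4) := p :+ n :+ con 4) refl n p)))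

countFrom4≡count : ∀ c k → countFrom4 c k ≡ count c k
countFrom4≡count c zero    = refl
countFrom4≡count c (suc k) = cong (_+ (if g3 (w k) ≟AB c then 1 else 0)) (countFrom4≡count c k)

Occ⇒IsOcc : ∀ {c n m} → Occ c n m → IsOcc c n m
Occ⇒IsOcc {c} {m = m} (h , e , k) = h , e , trans (countFrom4≡count c (m ∸ 4)) k

pairs-are-P : ∀ n → Σ ℕ λ x → Σ ℕ λ y → IsOcc a n x × IsOcc b n y × NonTermP 3 x y × x < y
pairs-are-P n = from-pair (pairing n)
  where
  from-pair : GappedPair n → Σ ℕ λ x → Σ ℕ λ y → IsOcc a n x × IsOcc b n y × NonTermP 3 x y × x < y
  from-pair (x , y , ox , oy , _) =
    x , y , Occ⇒IsOcc ox , Occ⇒IsOcc oy , Pair⇒nonterminalP pairing (n , ox , oy) , Pair-< pairing (n , ox , oy)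

P-are-pairs : ∀ x y → NonTermP 3 x y → x < y → Σ ℕ λ n → IsOcc a n x × IsOcc b n y
P-are-pairs x y (nt , p) x<y = from-pair (nonterminalP⇒Pair pairing nt p x<y)
  where
  from-pair : Pair x y → Σ ℕ λ n → IsOcc a n x × IsOcc b n y
  from-pair (n , ox , oy) = n , Occ⇒IsOcc ox , Occ⇒IsOcc oy

proposition25 :
    IsPhiMorphism f3 fix3
    × ((n : ℕ) → Σ ℕ (λ x → Σ ℕ (λ y →
         IsOcc a n x × IsOcc b n y × NonTermP 3 x y × x < y)))
    × ((x y : ℕ) → NonTermP 3 x y → x < y →
         Σ ℕ (λ n → IsOcc a n x × IsOcc b n y))
proposition25 = isPhiMorphism , pairs-are-P , P-are-pairs
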